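{- Up to permutations of $[r]$, the proper sublattices of $2^{[r]}$ that have more than $2^{r-1}$ elements are $L_i=2^{[r]}-U_i$ and $L'_i=2^{[r]}-U'_i$ for $1\le i<r$, where $$U_i=\bigcup_{1\le j\le i}[\{1,2,\dots,j\},\overline{\{j+1\}}]\quad\text{and}\quad U'_i=\bigcup_{1\le j\le i}[\{j+1\},\overline{\{1,2,\dots,j\}}],$$ and (when $r\ge4$) $L_V=2^{[r]}-V$ where $V=[\{1\},\overline{\{2\}}]\cup[\{3\},\overline{\{4\}}]$. Thus $|L_i|=|L'_i|=\bigl(\frac12+\frac1{2^{i+1}}\bigr)2^r$ and $|L_V|=\frac9{16}\cdot2^r$. Also, $L_V$ is not contained in any sublattice $L$ of $2^{[r]}$ with $|L|=\frac58\cdot 2^r$.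
   Context: $[r]=\{1,\dots,r\}$ and $2^{[r]}$ is the lattice of all subsets of $[r]$ under inclusion; a sublattice is a nonempty family of subsets closed under union and intersection. For $X\subseteq[r]$, $\overline{X}=[r]-X$. For $X\subseteq Y\subseteq[r]$, the interval $[X,Y]$ is $\{Z: X\subseteq Z\subseteq Y\}$. -}

module Defs where

open import Data.Bool using (Bool; true; false; not; _∧_; _∨_)
open import Data.Nat using (ℕ; zero; suc; _<ᵇ_; _≡ᵇ_)
open import Data.Fin using (Fin; toℕ)
open import Data.Fin.Subset using (Subset; _∪_; _∩_; ∁)
open import Data.Fin.Subset.Properties using (_⊆?_)
open import Data.Fin.Permutation using (Permutation′; _⟨$⟩ˡ_)
open import Data.Vec using (Vec; []; _∷_; tabulate; lookup)
open import Data.List using (List; []; _∷_; _++_; map; upTo; filter; length)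
open import Data.Bool.ListAction using (any)
open import Data.Product using (Σ; ∃; _×_)
open import Relation.Nullary using (does)
open import Relation.Binary.PropositionalEquality using (_≡_)

-- A family of subsets of [r] (elements 1..r are represented by Fin r, element k ↦ index k-1),
-- given by its (Boolean) membership function.
Family : ℕ → Set
Family r = Subset r → Bool

allSubsets : (r : ℕ) → List (Subset r)
allSubsets zero = [] ∷ []
allSubsets (suc r) = map (true ∷_) (allSubsets r) ++ map (false ∷_) (allSubsets r)

card : ∀ {r} → Family r → ℕ
card {r} L = length (filter (λ X → L X Data.Bool.≟ true) (allSubsets r))

IsSublattice : ∀ {r} → Family r → Set
IsSublattice {r} L =
  (∃ λ (X : Subset r) → L X ≡ true) ×
  (∀ X Y → L X ≡ true → L Y ≡ true → L (X ∪ Y) ≡ true) ×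
  (∀ X Y → L X ≡ true → L Y ≡ true → L (X ∩ Y) ≡ true)

IsProper : ∀ {r} → Family r → Set
IsProper {r} L = ∃ λ (X : Subset r) → L X ≡ false

_⊑_ : ∀ {r} → Family r → Family r → Set
_⊑_ {r} L M = ∀ (X : Subset r) → L X ≡ true → M X ≡ true

actSub : ∀ {r} → Permutation′ r → Subset r → Subset r
actSub σ X = tabulate (λ y → lookup X (σ ⟨$⟩ˡ y))

-- L is the image σ(M) of M under σ : Y ∈ L ⇔ σ⁻¹ Y ∈ M  (stated as L (σ X) = M X)
_≅[_]_ : ∀ {r} → Family r → Permutation′ r → Family r → Set
_≅[_]_ {r} L σ M = ∀ (X : Subset r) → L (actSub σ X) ≡ M X

interval : ∀ {r} → Subset r → Subset r → Family r
interval A B X = does (A ⊆? X) ∧ does (X ⊆? B)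

minus : ∀ {r} → Family r → Family r
minus F X = not (F X)

-- {1,2,...,j}  (indices 0..j-1)
initSeg : ∀ {r} → ℕ → Subset r
initSeg j = tabulate (λ k → toℕ k <ᵇ j)

-- {m}  for element m (1-based), i.e. index m-1
single : ∀ {r} → ℕ → Subset r
single m = tabulate (λ k → suc (toℕ k) ≡ᵇ m)

bigUnion : ∀ {r} → ℕ → (ℕ → Family r) → Family r
bigUnion i F X = any (λ j → F (suc j) X) (upTo i)

U : ∀ {r} → ℕ → Family r
U i = bigUnion i (λ j → interval (initSeg j) (∁ (single (suc j))))

U′ : ∀ {r} → ℕ → Family r
U′ i = bigUnion i (λ j → interval (single (suc j)) (∁ (initSeg j)))

V : ∀ {r} → Family r
V X = interval (single 1) (∁ (single 2)) X ∨ interval (single 3) (∁ (single 4)) X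

Lfam : ∀ {r} → ℕ → Family r
Lfam i = minus (U i)

L′fam : ∀ {r} → ℕ → Family r
L′fam i = minus (U′ i)

LV : ∀ {r} → Family r
LV = minus V

module Submission where

-- A sublattice L that large contains ∅ and [r] (it cannot avoid both X and ∁ X for all X), so
-- by Birkhoff's representation it is the family of sets closed under its arrows a ⇝ b ("every
-- member containing a contains b").  A family cut out by a Boolean pattern on k distinct points
-- has count · 2^(r-k) members; so arrow configurations of density at most 1/2 (a 2-cycle, a path
-- a → b → c, two disjoint arrows plus a third) cannot occur.  Hence the arrows of L form an
-- out-star (L ≅ L_i), an in-star (an out-star of the complemented lattice, L ≅ L′_i) or two
-- disjoint arrows (L ≅ L_V), the conjugating permutation placing the points in order.  Conversely
-- L_i, L′_i, L_V are closed-set families of dense patterns.  Lastly a sublattice above L_V only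
-- has arrows among 0 → 1, 2 → 3, so its size is 1, 3/4 or 9/16 of 2^r, never 5/8.
-- The file develops, in this order: sums over 2^[r], large families, patterns, closed-set
-- families and their conjugates, Birkhoff's representation, placements of points, the explicit
-- families, duality, the structure of large sublattices, and the theorem.

open import Defs
open import Data.Nat using (ℕ; suc; _+_; _*_; _^_; _≤_; _<_)
open import Data.Fin.Permutation using (Permutation′)
open import Data.Product using (Σ; ∃; _×_)
open import Data.Sum using (_⊎_)
open import Relation.Nullary using (¬_)
open import Relation.Binary.PropositionalEquality using (_≡_)

open import Data.Bool as Bool using (Bool; true; false; not; _∧_; _∨_; T; if_then_else_)
open import Data.Bool.ListAction using (any)
open import Data.Bool.Properties using (not-involutive; ∧-comm; ∧-zeroʳ)
open import Data.Empty using (⊥-elim) renaming (⊥ to Empty)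
open import Data.Fin using (Fin; zero; suc; toℕ; fromℕ<; inject≤)
open import Data.Fin.Patterns using (0F; 1F; 2F; 3F; 4F; 5F)
open import Data.Fin.Permutation as Perm using (_⟨$⟩ʳ_; _⟨$⟩ˡ_; _∘ₚ_)
import Data.Fin.Permutation.Components as PC
open import Data.Fin.Properties as Finₚ using (toℕ-injective; toℕ-fromℕ<; toℕ-inject≤; inject≤-injective; injective⇒≤)
open import Data.Fin.Subset using (Subset; _∪_; _∩_; ∁; ⊥; ⊤)
open import Data.Fin.Subset.Properties using (_⊆?_; p∪∁p≡⊤)
open import Data.List as List using (List; []; _∷_; _++_; length; applyUpTo; upTo)
open import Data.List.Membership.Propositional using (_∈_)
open import Data.List.Membership.Propositional.Properties using (∈-filter⁺; ∈-filter⁻; ∈-allFin; ∈-lookup)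
open import Data.List.Relation.Unary.All as All using (All; []; _∷_)
open import Data.List.Relation.Unary.Any using (here; there)
open import Data.List.Relation.Unary.Unique.Propositional using (Unique; []; _∷_)
open import Data.List.Relation.Unary.Unique.Propositional.Properties using (filter⁺; allFin⁺)
open import Data.Nat
open import Data.Nat.Properties
open import Data.Product using (_,_; proj₁; proj₂; map₂)
open import Data.Sum using (inj₁; inj₂)
open import Data.Unit using (tt) renaming (⊤ to Unit)
open import Data.Vec using (Vec; []; _∷_; lookup; tabulate; _[_]≔_)
open import Data.Vec.Properties using (lookup-zipWith; lookup-map; lookup-replicate; lookup∘tabulate; tabulate∘lookup; tabulate-cong; lookup∘update; lookup∘update′)
open import Function.Definitions using (Injective)
open import Relation.Binary.Definitions using (Decidable)
open import Relation.Binary.PropositionalEquality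
open import Relation.Nullary using (Dec; yes; no; contradiction; does)
open import Relation.Nullary.Decidable using (True; toWitness; dec-true; dec-false; ¬?; _×-dec_; _⊎-dec_)
import Relation.Unary as Unary
open import Algebra.Properties.CommutativeSemigroup +-commutativeSemigroup using (interchange)
open import Algebra.Properties.CommutativeSemigroup *-commutativeSemigroup using () renaming (x∙yz≈y∙xz to *-swap)

∧-intro : ∀ {a b} → a ≡ true → b ≡ true → a ∧ b ≡ true
∧-intro refl refl = refl

∧-elim : ∀ {a b} → a ∧ b ≡ true → a ≡ true × b ≡ true
∧-elim {true} {true} _ = refl , refl

∨-introˡ : ∀ {a b} → a ≡ true → a ∨ b ≡ true
∨-introˡ refl = refl

∨-introʳ : ∀ {a b} → b ≡ true → a ∨ b ≡ true
∨-introʳ {true} _ = refl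
∨-introʳ {false} p = p

∨-elim : ∀ {a b} → a ∨ b ≡ true → a ≡ true ⊎ b ≡ true
∨-elim {true} _ = inj₁ refl
∨-elim {false} p = inj₂ p

not-true : ∀ {a} → not a ≡ true → a ≡ false
not-true {false} _ = refl

not-false : ∀ {a} → a ≡ false → not a ≡ true
not-false refl = refl

T⇒true : ∀ {a} → T a → a ≡ true
T⇒true {true} _ = refl

true⇒T : ∀ {a} → a ≡ true → T a
true⇒T refl = _

false≢true : ∀ {a} → a ≡ false → a ≡ true → Empty
false≢true refl ()

¬true⇒false : ∀ {a} → ¬ a ≡ true → a ≡ false
¬true⇒false {true} a≢true = ⊥-elim (a≢true refl)
¬true⇒false {false} _ = refl

bool-ext : ∀ {a b} → (a ≡ true → b ≡ true) → (b ≡ true → a ≡ true) → a ≡ b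
bool-ext {true} to from = sym (to refl)
bool-ext {false} {true} to from = from refl
bool-ext {false} {false} to from = refl

infix 4 _∊_
_∊_ : ∀ {n} → Fin n → Subset n → Set
a ∊ X = lookup X a ≡ true

lookup-∪ : ∀ {n} (X Y : Subset n) i → lookup (X ∪ Y) i ≡ lookup X i ∨ lookup Y i
lookup-∪ X Y i = lookup-zipWith _∨_ i X Y

lookup-∩ : ∀ {n} (X Y : Subset n) i → lookup (X ∩ Y) i ≡ lookup X i ∧ lookup Y i
lookup-∩ X Y i = lookup-zipWith _∧_ i X Y

lookup-∁ : ∀ {n} (X : Subset n) i → lookup (∁ X) i ≡ not (lookup X i)
lookup-∁ X i = lookup-map i not X

lookup-⊥ : ∀ {n} i → lookup (⊥ {n}) i ≡ false
lookup-⊥ i = lookup-replicate i false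

lookup-⊤ : ∀ {n} i → lookup (⊤ {n}) i ≡ true
lookup-⊤ i = lookup-replicate i true

∊-∁⇒ : ∀ {n} (X : Subset n) k → k ∊ ∁ X → ¬ k ∊ X
∊-∁⇒ X k k∊∁X k∊X = false≢true (trans (lookup-∁ X k) (cong not k∊X)) k∊∁X

∊-∁⇐ : ∀ {n} (X : Subset n) k → ¬ k ∊ X → k ∊ ∁ X
∊-∁⇐ X k k∉X = trans (lookup-∁ X k) (not-false (¬true⇒false k∉X))

subset-ext : ∀ {n} {X Y : Subset n} → (∀ i → lookup X i ≡ lookup Y i) → X ≡ Y
subset-ext {X = X} {Y} e = trans (sym (tabulate∘lookup X)) (trans (tabulate-cong e) (tabulate∘lookup Y))

∁-involutive : ∀ {n} (X : Subset n) → ∁ (∁ X) ≡ X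
∁-involutive [] = refl
∁-involutive (x ∷ X) = cong₂ _∷_ (not-involutive x) (∁-involutive X)

p∩∁p≡⊥ : ∀ {n} (X : Subset n) → X ∩ ∁ X ≡ ⊥
p∩∁p≡⊥ [] = refl
p∩∁p≡⊥ (true ∷ X) = cong (false ∷_) (p∩∁p≡⊥ X)
p∩∁p≡⊥ (false ∷ X) = cong (false ∷_) (p∩∁p≡⊥ X)

χ : Bool → ℕ
χ true = 1
χ false = 0

sumSubsets : ∀ r → (Subset r → ℕ) → ℕ
sumSubsets zero h = h []
sumSubsets (suc r) h = sumSubsets r (λ X → h (true ∷ X)) + sumSubsets r (λ X → h (false ∷ X))

size : ∀ {r} → Family r → ℕ
size {r} F = sumSubsets r (λ X → χ (F X))

sumSubsets-cong : ∀ r {h h′ : Subset r → ℕ} → (∀ X → h X ≡ h′ X) → sumSubsets r h ≡ sumSubsets r h′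
sumSubsets-cong zero e = e []
sumSubsets-cong (suc r) e =
  cong₂ _+_ (sumSubsets-cong r (λ X → e (true ∷ X))) (sumSubsets-cong r (λ X → e (false ∷ X)))

sumSubsets-+ : ∀ r (h h′ : Subset r → ℕ) →
  sumSubsets r (λ X → h X + h′ X) ≡ sumSubsets r h + sumSubsets r h′
sumSubsets-+ zero h h′ = refl
sumSubsets-+ (suc r) h h′
  rewrite sumSubsets-+ r (λ X → h (true ∷ X)) (λ X → h′ (true ∷ X))
        | sumSubsets-+ r (λ X → h (false ∷ X)) (λ X → h′ (false ∷ X)) =
  interchange (sumSubsets r (λ X → h (true ∷ X))) (sumSubsets r (λ X → h′ (true ∷ X)))
              (sumSubsets r (λ X → h (false ∷ X))) (sumSubsets r (λ X → h′ (false ∷ X)))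

sumSubsets-mono : ∀ r {h h′ : Subset r → ℕ} → (∀ X → h X ≤ h′ X) → sumSubsets r h ≤ sumSubsets r h′
sumSubsets-mono zero e = e []
sumSubsets-mono (suc r) e =
  +-mono-≤ (sumSubsets-mono r (λ X → e (true ∷ X))) (sumSubsets-mono r (λ X → e (false ∷ X)))

sumSubsets-const : ∀ r c → sumSubsets r (λ _ → c) ≡ 2 ^ r * c
sumSubsets-const zero c = sym (+-identityʳ c)
sumSubsets-const (suc r) c rewrite sumSubsets-const r c =
  sym (trans (*-assoc 2 (2 ^ r) c) (cong (2 ^ r * c +_) (+-identityʳ _)))

card≡size : ∀ {r} (F : Family r) → card F ≡ size F
card≡size {r} F = trans (length-filter (allSubsets r)) (sumList-allSubsets r F)
  where
  sumList : ∀ {s} → Family s → List (Subset s) → ℕ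
  sumList G [] = 0
  sumList G (X ∷ Xs) = χ (G X) + sumList G Xs

  length-filter : ∀ Xs → List.length (List.filter (λ X → F X Bool.≟ true) Xs) ≡ sumList F Xs
  length-filter [] = refl
  length-filter (X ∷ Xs) with F X
  ... | true = cong suc (length-filter Xs)
  ... | false = length-filter Xs

  sumList-++ : ∀ {s} (G : Family s) Xs Ys → sumList G (Xs ++ Ys) ≡ sumList G Xs + sumList G Ys
  sumList-++ G [] Ys = refl
  sumList-++ G (X ∷ Xs) Ys rewrite sumList-++ G Xs Ys = sym (+-assoc (χ (G X)) _ _)

  sumList-map : ∀ {s t} (G : Family s) (f : Subset t → Subset s) Xs →
    sumList G (List.map f Xs) ≡ sumList (λ X → G (f X)) Xs
  sumList-map G f [] = refl
  sumList-map G f (X ∷ Xs) = cong (χ (G (f X)) +_) (sumList-map G f Xs)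

  sumList-allSubsets : ∀ s (G : Family s) → sumList G (allSubsets s) ≡ size G
  sumList-allSubsets zero G = +-identityʳ _
  sumList-allSubsets (suc s) G = begin
    sumList G (List.map (true ∷_) (allSubsets s) ++ List.map (false ∷_) (allSubsets s))
      ≡⟨ sumList-++ G (List.map (true ∷_) (allSubsets s)) (List.map (false ∷_) (allSubsets s)) ⟩
    sumList G (List.map (true ∷_) (allSubsets s)) + sumList G (List.map (false ∷_) (allSubsets s))
      ≡⟨ cong₂ _+_ (sumList-map G (true ∷_) (allSubsets s)) (sumList-map G (false ∷_) (allSubsets s)) ⟩
    sumList (λ X → G (true ∷ X)) (allSubsets s) + sumList (λ X → G (false ∷ X)) (allSubsets s)
      ≡⟨ cong₂ _+_ (sumList-allSubsets s _) (sumList-allSubsets s _) ⟩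
    size G ∎
    where open ≡-Reasoning

sumSubsets-∁ : ∀ r (h : Subset r → ℕ) → sumSubsets r (λ X → h (∁ X)) ≡ sumSubsets r h
sumSubsets-∁ zero h = refl
sumSubsets-∁ (suc r) h =
  trans (cong₂ _+_ (sumSubsets-∁ r (λ X → h (false ∷ X))) (sumSubsets-∁ r (λ X → h (true ∷ X))))
        (+-comm (sumSubsets r (λ X → h (false ∷ X))) _)

-- Forcing coordinate c to either value and summing over both visits every subset twice.
sumSubsets-set : ∀ r (c : Fin r) (h : Subset r → ℕ) →
  sumSubsets r (λ X → h (X [ c ]≔ true)) + sumSubsets r (λ X → h (X [ c ]≔ false)) ≡ 2 * sumSubsets r h
sumSubsets-set (suc r) zero h = begin
  (A + A) + (B + B) ≡⟨ interchange A A B B ⟩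
  (A + B) + (A + B) ≡⟨ cong ((A + B) +_) (sym (+-identityʳ (A + B))) ⟩
  2 * (A + B) ∎
  where
  open ≡-Reasoning
  A B : ℕ
  A = sumSubsets r (λ X → h (true ∷ X))
  B = sumSubsets r (λ X → h (false ∷ X))
sumSubsets-set (suc r) (suc c) h = begin
  (St + Ft) + (Sf + Ff) ≡⟨ interchange St Ft Sf Ff ⟩
  (St + Sf) + (Ft + Ff) ≡⟨ cong₂ _+_ (sumSubsets-set r c (λ X → h (true ∷ X))) (sumSubsets-set r c (λ X → h (false ∷ X))) ⟩
  2 * sumSubsets r (λ X → h (true ∷ X)) + 2 * sumSubsets r (λ X → h (false ∷ X))
    ≡⟨ sym (*-distribˡ-+ 2 (sumSubsets r (λ X → h (true ∷ X))) _) ⟩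
  2 * sumSubsets (suc r) h ∎
  where
  open ≡-Reasoning
  St Ft Sf Ff : ℕ
  St = sumSubsets r (λ X → h (true ∷ (X [ c ]≔ true)))
  Ft = sumSubsets r (λ X → h (false ∷ (X [ c ]≔ true)))
  Sf = sumSubsets r (λ X → h (true ∷ (X [ c ]≔ false)))
  Ff = sumSubsets r (λ X → h (false ∷ (X [ c ]≔ false)))

size-cong : ∀ {r} {F G : Family r} → (∀ X → F X ≡ G X) → size F ≡ size G
size-cong {r} e = sumSubsets-cong r (λ X → cong χ (e X))

size-mono : ∀ {r} {F G : Family r} → (∀ X → F X ≡ true → G X ≡ true) → size F ≤ size G
size-mono {r} {F} {G} F⊑G = sumSubsets-mono r χ-mono
  where
  χ-mono : ∀ X → χ (F X) ≤ χ (G X)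
  χ-mono X with F X in eq
  ... | false = z≤n
  ... | true rewrite F⊑G X eq = ≤-refl

size-∁ : ∀ {r} (F : Family r) → size (λ X → F (∁ X)) ≡ size F
size-∁ {r} F = sumSubsets-∁ r (λ X → χ (F X))

size-disjoint : ∀ {r} (F G : Family r) → (∀ X → F X ≡ true → G X ≡ true → Empty) →
  size F + size G ≤ 2 ^ r
size-disjoint {r} F G disj = begin
  size F + size G                           ≡⟨ sym (sumSubsets-+ r _ _) ⟩
  sumSubsets r (λ X → χ (F X) + χ (G X))    ≤⟨ sumSubsets-mono r (λ X → atMostOne (F X) (G X) (disj X)) ⟩
  sumSubsets r (λ _ → 1)                    ≡⟨ trans (sumSubsets-const r 1) (*-identityʳ _) ⟩
  2 ^ r ∎
  where
  open ≤-Reasoning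
  atMostOne : ∀ a b → (a ≡ true → b ≡ true → Empty) → χ a + χ b ≤ 1
  atMostOne true true d = ⊥-elim (d refl refl)
  atMostOne true false d = ≤-refl
  atMostOne false b d = χ≤1 b
    where χ≤1 : ∀ c → χ c ≤ 1
          χ≤1 true = ≤-refl
          χ≤1 false = z≤n

half-bound : ∀ {r} (F : Family r) → (∀ X → F X ≡ true → F (∁ X) ≡ true → Empty) → 2 * size F ≤ 2 ^ r
half-bound {r} F noPair = begin
  2 * size F                    ≡⟨ cong (size F +_) (+-identityʳ _) ⟩
  size F + size F               ≡⟨ cong (size F +_) (sym (size-∁ F)) ⟩
  size F + size (λ X → F (∁ X)) ≤⟨ size-disjoint F (λ X → F (∁ X)) noPair ⟩
  2 ^ r ∎
  where open ≤-Reasoning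

∪-Closed : ∀ {r} → Family r → Set
∪-Closed {r} L = ∀ (X Y : Subset r) → L X ≡ true → L Y ≡ true → L (X ∪ Y) ≡ true

∩-Closed : ∀ {r} → Family r → Set
∩-Closed {r} L = ∀ (X Y : Subset r) → L X ≡ true → L Y ≡ true → L (X ∩ Y) ≡ true

Large : ∀ {r} → Family r → Set
Large {r} L = 2 ^ r < 2 * size L

-- A large ∩-closed family contains ∅: otherwise X ∩ ∁ X = ∅ forbids complementary pairs.
large-∋⊥ : ∀ {r} (L : Family r) → ∩-Closed L → Large L → L ⊥ ≡ true
large-∋⊥ L closed big with L ⊥ in eq
... | true = refl
... | false = ⊥-elim (<⇒≱ big (half-bound L noPair))
  where
  noPair : ∀ X → L X ≡ true → L (∁ X) ≡ true → Empty
  noPair X LX L∁X = false≢true eq (subst (λ Z → L Z ≡ true) (p∩∁p≡⊥ X) (closed X (∁ X) LX L∁X))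

large-∋⊤ : ∀ {r} (L : Family r) → ∪-Closed L → Large L → L ⊤ ≡ true
large-∋⊤ L closed big with L ⊤ in eq
... | true = refl
... | false = ⊥-elim (<⇒≱ big (half-bound L noPair))
  where
  noPair : ∀ X → L X ≡ true → L (∁ X) ≡ true → Empty
  noPair X LX L∁X = false≢true eq (subst (λ Z → L Z ≡ true) (p∪∁p≡⊤ X) (closed X (∁ X) LX L∁X))

count : ∀ k → (Vec Bool k → Bool) → ℕ
count zero P = χ (P [])
count (suc k) P = count k (λ v → P (true ∷ v)) + count k (λ v → P (false ∷ v))

Pattern : ∀ {r k} → (Vec Bool k → Bool) → (Fin k → Fin r) → Family r
Pattern P c X = P (tabulate (λ j → lookup X (c j)))

-- On k distinct coordinates, a pattern contains the proportion count/2^k of all subsets: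
-- forcing the first coordinate to true or to false splits the count, by sumSubsets-set.
pattern-size : ∀ {r} k (P : Vec Bool k → Bool) (c : Fin k → Fin r) → Injective _≡_ _≡_ c →
  2 ^ k * size (Pattern P c) ≡ count k P * 2 ^ r
pattern-size {r} zero P c _ =
  trans (+-identityʳ _) (trans (sumSubsets-const r (χ (P []))) (*-comm (2 ^ r) _))
pattern-size {r} (suc k) P c injective = begin
  2 * 2 ^ k * size G                      ≡⟨ trans (*-assoc 2 (2 ^ k) _) (*-swap 2 (2 ^ k) _) ⟩
  2 ^ k * (2 * size G)                    ≡⟨ cong (2 ^ k *_) (sym (sumSubsets-set r (c zero) (λ X → χ (G X)))) ⟩
  2 ^ k * (size (forced true) + size (forced false))
    ≡⟨ *-distribˡ-+ (2 ^ k) (size (forced true)) (size (forced false)) ⟩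
  2 ^ k * size (forced true) + 2 ^ k * size (forced false)
    ≡⟨ cong₂ _+_ (trans (cong (2 ^ k *_) (size-cong (forced≡ true))) (pattern-size k _ (λ j → c (suc j)) tail-injective))
                 (trans (cong (2 ^ k *_) (size-cong (forced≡ false))) (pattern-size k _ (λ j → c (suc j)) tail-injective)) ⟩
  count k (λ v → P (true ∷ v)) * 2 ^ r + count k (λ v → P (false ∷ v)) * 2 ^ r
    ≡⟨ sym (*-distribʳ-+ (2 ^ r) (count k (λ v → P (true ∷ v))) _) ⟩
  count (suc k) P * 2 ^ r ∎
  where
  open ≡-Reasoning
  G : Family r
  G = Pattern P c
  forced : Bool → Family r
  forced v X = G (X [ c zero ]≔ v)
  tail-injective : Injective _≡_ _≡_ (λ j → c (suc j))
  tail-injective e = Finₚ.suc-injective (injective e)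
  forced≡ : ∀ v X → forced v X ≡ Pattern (λ w → P (v ∷ w)) (λ j → c (suc j)) X
  forced≡ v X = cong₂ (λ x w → P (x ∷ w)) (lookup∘update (c zero) X v)
    (tabulate-cong (λ j → lookup∘update′ (λ e → Finₚ.0≢1+n (sym (injective e))) X v))

pattern-bound : ∀ {r} k (P : Vec Bool k → Bool) (c : Fin k → Fin r) → Injective _≡_ _≡_ c →
  (F : Family r) → (∀ X → F X ≡ true → Pattern P c X ≡ true) → 2 * count k P ≤ 2 ^ k → 2 * size F ≤ 2 ^ r
pattern-bound {r} k P c injective F F⊑P sparse = *-cancelˡ-≤ (2 ^ k) {{m^n≢0 2 k}} (begin
  2 ^ k * (2 * size F)              ≤⟨ *-monoʳ-≤ (2 ^ k) (*-monoʳ-≤ 2 (size-mono F⊑P)) ⟩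
  2 ^ k * (2 * size (Pattern P c))  ≡⟨ *-swap (2 ^ k) 2 _ ⟩
  2 * (2 ^ k * size (Pattern P c))  ≡⟨ cong (2 *_) (pattern-size k P c injective) ⟩
  2 * (count k P * 2 ^ r)           ≡⟨ sym (*-assoc 2 (count k P) (2 ^ r)) ⟩
  2 * count k P * 2 ^ r             ≤⟨ *-monoˡ-≤ (2 ^ r) sparse ⟩
  2 ^ k * 2 ^ r ∎)
  where open ≤-Reasoning

pattern-large : ∀ {r} k (P : Vec Bool k → Bool) (c : Fin k → Fin r) → Injective _≡_ _≡_ c →
  2 ^ k < 2 * count k P → Large (Pattern P c)
pattern-large {r} k P c injective dense = *-cancelˡ-< (2 ^ k) (2 ^ r) _ (begin-strict
  2 ^ k * 2 ^ r                     <⟨ *-monoˡ-< (2 ^ r) {{m^n≢0 2 r}} dense ⟩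
  2 * count k P * 2 ^ r             ≡⟨ *-assoc 2 (count k P) (2 ^ r) ⟩
  2 * (count k P * 2 ^ r)           ≡⟨ cong (2 *_) (sym (pattern-size k P c injective)) ⟩
  2 * (2 ^ k * size (Pattern P c))  ≡⟨ *-swap 2 (2 ^ k) _ ⟩
  2 ^ k * (2 * size (Pattern P c)) ∎)
  where open ≤-Reasoning

-- A relation on the points of [r]; we think of R a b as an arrow a → b.
Arrows : ℕ → Set₁
Arrows r = Fin r → Fin r → Set

Closed : ∀ {r} → Arrows r → Subset r → Set
Closed R X = ∀ a b → R a b → a ∊ X → b ∊ X

ClosedFamily : ∀ {r} → Arrows r → Family r → Set
ClosedFamily R L = ∀ X → (L X ≡ true → Closed R X) × (Closed R X → L X ≡ true)

closed-⊤ : ∀ {r} (R : Arrows r) → Closed R ⊤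
closed-⊤ R a b _ _ = lookup-⊤ b

closed-∪ : ∀ {r} (R : Arrows r) X Y → Closed R X → Closed R Y → Closed R (X ∪ Y)
closed-∪ R X Y cX cY a b Rab a∊X∪Y with ∨-elim (trans (sym (lookup-∪ X Y a)) a∊X∪Y)
... | inj₁ a∊X = trans (lookup-∪ X Y b) (∨-introˡ (cX a b Rab a∊X))
... | inj₂ a∊Y = trans (lookup-∪ X Y b) (∨-introʳ {lookup X b} (cY a b Rab a∊Y))

closed-∩ : ∀ {r} (R : Arrows r) X Y → Closed R X → Closed R Y → Closed R (X ∩ Y)
closed-∩ R X Y cX cY a b Rab a∊X∩Y with ∧-elim {lookup X a} (trans (sym (lookup-∩ X Y a)) a∊X∩Y)
... | a∊X , a∊Y = trans (lookup-∩ X Y b) (∧-intro (cX a b Rab a∊X) (cY a b Rab a∊Y))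

closedFamily-sublattice : ∀ {r} (R : Arrows r) (L : Family r) → ClosedFamily R L → IsSublattice L
closedFamily-sublattice R L char =
  (⊤ , proj₂ (char ⊤) (closed-⊤ R)) ,
  (λ X Y LX LY → proj₂ (char (X ∪ Y)) (closed-∪ R X Y (proj₁ (char X) LX) (proj₁ (char Y) LY))) ,
  (λ X Y LX LY → proj₂ (char (X ∩ Y)) (closed-∩ R X Y (proj₁ (char X) LX) (proj₁ (char Y) LY)))

-- Only the arrows between distinct points matter for closedness.
SameArrows : ∀ {r} → Arrows r → Arrows r → Set
SameArrows R S = (∀ a b → a ≢ b → R a b → S a b) × (∀ a b → a ≢ b → S a b → R a b)

closed-transfer : ∀ {r} {R S : Arrows r} → (∀ a b → a ≢ b → S a b → R a b) → ∀ X → Closed R X → Closed S X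
closed-transfer S⊆R X closedR a b Sab a∊X with a Finₚ.≟ b
... | yes refl = a∊X
... | no a≢b = closedR a b (S⊆R a b a≢b Sab) a∊X

_along_ : ∀ {r} → Arrows r → Permutation′ r → Arrows r
(R along σ) a b = R (σ ⟨$⟩ʳ a) (σ ⟨$⟩ʳ b)

lookup-act : ∀ {r} (σ : Permutation′ r) X y → lookup (actSub σ X) y ≡ lookup X (σ ⟨$⟩ˡ y)
lookup-act σ X y = lookup∘tabulate _ y

act-flip : ∀ {r} (σ : Permutation′ r) Y → actSub σ (actSub (Perm.flip σ) Y) ≡ Y
act-flip σ Y = subset-ext (λ y →
  trans (lookup-act σ (actSub (Perm.flip σ) Y) y) (trans (lookup-act (Perm.flip σ) Y _) (cong (lookup Y) (Perm.inverseʳ σ))))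

closed-act⇒ : ∀ {r} (R : Arrows r) σ X → Closed R (actSub σ X) → Closed (R along σ) X
closed-act⇒ R σ X closed a b Rab a∊X =
  subst (_∊ X) (Perm.inverseˡ σ) (trans (sym (lookup-act σ X _)) (closed _ _ Rab (trans (lookup-act σ X _) (subst (_∊ X) (sym (Perm.inverseˡ σ)) a∊X))))

closed-act⇐ : ∀ {r} (R : Arrows r) σ X → Closed (R along σ) X → Closed R (actSub σ X)
closed-act⇐ R σ X closed p q Rpq p∊σX =
  trans (lookup-act σ X q) (closed _ _ (subst₂ R (sym (Perm.inverseʳ σ)) (sym (Perm.inverseʳ σ)) Rpq) (trans (sym (lookup-act σ X p)) p∊σX))

conjugate : ∀ {r} {R S : Arrows r} {L M : Family r} (σ : Permutation′ r) →
  ClosedFamily R L → ClosedFamily S M → SameArrows (R along σ) S → L ≅[ σ ] M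
conjugate {R = R} {S} σ charL charM (RσS , SRσ) X = bool-ext
  (λ LσX → proj₂ (charM X) (closed-transfer SRσ X (closed-act⇒ R σ X (proj₁ (charL (actSub σ X)) LσX))))
  (λ MX → proj₂ (charL (actSub σ X)) (closed-act⇐ R σ X (closed-transfer RσS X (proj₁ (charM X) MX))))

conjugate-closed : ∀ {r} {S : Arrows r} {L M : Family r} (σ : Permutation′ r) →
  L ≅[ σ ] M → ClosedFamily S M → ClosedFamily (S along Perm.flip σ) L
conjugate-closed {S = S} {L} {M} σ L≅M charM Y =
  (λ LY → closed-act⇒ S (Perm.flip σ) Y (proj₁ (charM _) (trans (sym (L-via Y)) LY))) ,
  (λ closed → trans (L-via Y) (proj₂ (charM _) (closed-act⇐ S (Perm.flip σ) Y closed)))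
  where
  L-via : ∀ Y → L Y ≡ M (actSub (Perm.flip σ) Y)
  L-via Y = trans (cong L (sym (act-flip σ Y))) (L≅M _)

meetAll : ∀ {n} r → (Subset r → Subset n) → Subset n
meetAll zero h = h []
meetAll (suc r) h = meetAll r (λ X → h (true ∷ X)) ∩ meetAll r (λ X → h (false ∷ X))

meetAll-lower : ∀ {n} r (h : Subset r → Subset n) X i →
  lookup (meetAll r h) i ≡ true → lookup (h X) i ≡ true
meetAll-lower zero h [] i p = p
meetAll-lower (suc r) h (true ∷ X) i p =
  meetAll-lower r _ X i (proj₁ (∧-elim (trans (sym (lookup-∩ (meetAll r _) (meetAll r _) i)) p)))
meetAll-lower (suc r) h (false ∷ X) i p =
  meetAll-lower r _ X i (proj₂ (∧-elim (trans (sym (lookup-∩ (meetAll r _) (meetAll r _) i)) p)))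

meetAll-greatest : ∀ {n} r (h : Subset r → Subset n) i →
  (∀ X → lookup (h X) i ≡ true) → lookup (meetAll r h) i ≡ true
meetAll-greatest zero h i p = p []
meetAll-greatest (suc r) h i p = trans (lookup-∩ (meetAll r _) (meetAll r _) i)
  (∧-intro (meetAll-greatest r _ i (λ X → p (true ∷ X))) (meetAll-greatest r _ i (λ X → p (false ∷ X))))

meetAll-closed : ∀ {n} r (L : Family n) → ∩-Closed L →
  (h : Subset r → Subset n) → (∀ X → L (h X) ≡ true) → L (meetAll r h) ≡ true
meetAll-closed zero L closed h p = p []
meetAll-closed (suc r) L closed h p =
  closed _ _ (meetAll-closed r L closed _ (λ X → p (true ∷ X))) (meetAll-closed r L closed _ (λ X → p (false ∷ X)))

joinFin : ∀ {n} m → (Fin m → Subset n) → Subset n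
joinFin zero h = ⊥
joinFin (suc m) h = h zero ∪ joinFin m (λ a → h (suc a))

joinFin-upper : ∀ {n} m (h : Fin m → Subset n) i a →
  lookup (h a) i ≡ true → lookup (joinFin m h) i ≡ true
joinFin-upper (suc m) h i zero p = trans (lookup-∪ (h zero) _ i) (∨-introˡ p)
joinFin-upper (suc m) h i (suc a) p =
  trans (lookup-∪ (h zero) _ i) (∨-introʳ {lookup (h zero) i} (joinFin-upper m _ i a p))

joinFin-least : ∀ {n} m (h : Fin m → Subset n) i →
  (∀ a → lookup (h a) i ≡ false) → lookup (joinFin m h) i ≡ false
joinFin-least zero h i p = lookup-⊥ i
joinFin-least (suc m) h i p =
  trans (lookup-∪ (h zero) _ i) (cong₂ _∨_ (p zero) (joinFin-least m _ i (λ a → p (suc a))))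

joinFin-closed : ∀ {n} m (L : Family n) → L ⊥ ≡ true → ∪-Closed L →
  (h : Fin m → Subset n) → (∀ a → L (h a) ≡ true) → L (joinFin m h) ≡ true
joinFin-closed zero L L⊥ closed h p = L⊥
joinFin-closed (suc m) L L⊥ closed h p =
  closed _ _ (p zero) (joinFin-closed m L L⊥ closed _ (λ a → p (suc a)))

-- Birkhoff's representation of a sublattice L containing ∅ and [r]: with the preorder
-- a ⇝ b ("every member of L containing a contains b"), the members of L are exactly
-- the ⇝-up-closed subsets of [r].
module Birkhoff {r} (L : Family r) (∪-closed : ∪-Closed L) (∩-closed : ∩-Closed L)
              (L∋⊥ : L ⊥ ≡ true) (L∋⊤ : L ⊤ ≡ true) where

  -- ↑ a is the least member of L containing a: the intersection of all such members.
  ↑_ : Fin r → Subset r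
  ↑ a = meetAll r (λ Y → if L Y ∧ lookup Y a then Y else ⊤)

  infix 4 _⇝_ _⇝?_
  _⇝_ : Fin r → Fin r → Set
  a ⇝ b = lookup (↑ a) b ≡ true

  _⇝?_ : Decidable _⇝_
  a ⇝? b = lookup (↑ a) b Bool.≟ true

  ↑-member : ∀ a → L (↑ a) ≡ true
  ↑-member a = meetAll-closed r L ∩-closed _ member
    where
    member : ∀ Y → L (if L Y ∧ lookup Y a then Y else ⊤) ≡ true
    member Y with L Y in LY | lookup Y a
    ... | true | true = LY
    ... | true | false = L∋⊤
    ... | false | _ = L∋⊤

  ⇝-refl : ∀ a → a ⇝ a
  ⇝-refl a = meetAll-greatest r _ a contains
    where
    contains : ∀ Y → lookup (if L Y ∧ lookup Y a then Y else ⊤) a ≡ true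
    contains Y with L Y | lookup Y a in Ya
    ... | true | true = Ya
    ... | true | false = lookup-⊤ a
    ... | false | _ = lookup-⊤ a

  ⇝-elim : ∀ {a b} → a ⇝ b → ∀ Y → L Y ≡ true → a ∊ Y → b ∊ Y
  ⇝-elim {a} {b} a⇝b Y LY a∊Y = subst (b ∊_) chosen (meetAll-lower r _ Y b a⇝b)
    where
    chosen : (if L Y ∧ lookup Y a then Y else ⊤) ≡ Y
    chosen rewrite LY | a∊Y = refl

  ⇝-intro : ∀ {a b} → (∀ Y → L Y ≡ true → a ∊ Y → b ∊ Y) → a ⇝ b
  ⇝-intro {a} above = above (↑ a) (↑-member a) (⇝-refl a)

  -- Conversely a ⇝-closed X is the union of the members ↑ a, a ∈ X, of L.
  closed⇒member : ∀ X → Closed _⇝_ X → L X ≡ true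
  closed⇒member X closedX = subst (λ Z → L Z ≡ true) (subset-ext union≡X) (joinFin-closed r L L∋⊥ ∪-closed generator inL)
    where
    generator : Fin r → Subset r
    generator a = if lookup X a then ↑ a else ⊥

    inL : ∀ a → L (generator a) ≡ true
    inL a with lookup X a
    ... | true = ↑-member a
    ... | false = L∋⊥

    union≡X : ∀ b → lookup (joinFin r generator) b ≡ lookup X b
    union≡X b with lookup X b in b∊X
    ... | true = joinFin-upper r generator b b (subst (λ c → b ∊ (if c then ↑ b else ⊥)) (sym b∊X) (⇝-refl b))
    ... | false = joinFin-least r generator b outside
      where
      outside : ∀ a → lookup (generator a) b ≡ false
      outside a with lookup X a in a∊X
      ... | false = lookup-⊥ b
      ... | true with lookup (↑ a) b in a⇝b
      ...   | false = refl
      ...   | true = ⊥-elim (false≢true b∊X (closedX a b a⇝b a∊X))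

  birkhoff : ClosedFamily _⇝_ L
  birkhoff X = (λ LX a b a⇝b → ⇝-elim a⇝b X LX) , closed⇒member X

unique-lookup-injective : ∀ {A : Set} {xs : List A} → Unique xs → ∀ i j → List.lookup xs i ≡ List.lookup xs j → i ≡ j
unique-lookup-injective (_ ∷ _) zero zero _ = refl
unique-lookup-injective (x∉ ∷ _) zero (suc j) e = contradiction e (All.lookup x∉ (∈-lookup j))
unique-lookup-injective (x∉ ∷ _) (suc i) zero e = contradiction (sym e) (All.lookup x∉ (∈-lookup i))
unique-lookup-injective (_ ∷ u) (suc i) (suc j) e = cong suc (unique-lookup-injective u i j e)

unique-length : ∀ {r} {ys : List (Fin r)} → Unique ys → length ys ≤ r
unique-length u = injective⇒≤ (unique-lookup-injective u _ _)

transpose-left : ∀ {r} (i j : Fin r) → PC.transpose i j i ≡ j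
transpose-left i j rewrite dec-true (i Finₚ.≟ i) refl = refl

transpose-other : ∀ {r} {i j k : Fin r} → k ≢ i → k ≢ j → PC.transpose i j k ≡ k
transpose-other {i = i} {j} {k} k≢i k≢j rewrite dec-false (k Finₚ.≟ i) k≢i | dec-false (k Finₚ.≟ j) k≢j = refl

Placed : ∀ {r} → Permutation′ r → List (Fin r) → ℕ → Set
Placed σ [] n = Unit
Placed σ (y ∷ ys) n = toℕ (σ ⟨$⟩ˡ y) ≡ n × Placed σ ys (suc n)

place : ∀ {r} (ys : List (Fin r)) n → Unique ys → n + length ys ≤ r → Σ (Permutation′ r) (λ σ → Placed σ ys n)
place [] n _ _ = Perm.id , tt
place {r} (y ∷ ys) n (y∉ys ∷ u) room with place ys (suc n) u (subst (_≤ r) (+-suc n (length ys)) room)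
... | σ , placed = τ ∘ₚ σ , trans (cong toℕ (transpose-left z w)) (toℕ-fromℕ< _) , keep ys (suc n) y∉ys placed ≤-refl
  where
  z : Fin r
  z = σ ⟨$⟩ˡ y
  w : Fin r
  w = fromℕ< (≤-trans (s≤s (m≤m+n n (length ys))) (subst (_≤ r) (+-suc n (length ys)) room))
  τ : Permutation′ r
  τ = Perm.transpose w z
  -- the transposition does not move the positions already given to ys
  keep : ∀ ys′ m → All (y ≢_) ys′ → Placed σ ys′ m → suc n ≤ m → Placed (τ ∘ₚ σ) ys′ m
  keep [] m _ _ _ = tt
  keep (y′ ∷ ys′) m (y≢y′ ∷ y∉) (at , placed′) n<m =
    trans (cong toℕ (transpose-other (λ e → y≢y′ (sym (σ-injective e))) away)) at , keep ys′ (suc m) y∉ placed′ (m≤n⇒m≤1+n n<m)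
    where
    σ-injective : ∀ {p q} → σ ⟨$⟩ˡ p ≡ σ ⟨$⟩ˡ q → p ≡ q
    σ-injective {p} {q} e = trans (sym (Perm.inverseʳ σ)) (trans (cong (σ ⟨$⟩ʳ_) e) (Perm.inverseʳ σ))
    away : σ ⟨$⟩ˡ y′ ≢ w
    away e = <-irrefl (sym (trans (sym at) (trans (cong toℕ e) (toℕ-fromℕ< _)))) n<m

placed-at : ∀ {r} (σ : Permutation′ r) {y k} → toℕ (σ ⟨$⟩ˡ y) ≡ toℕ k → σ ⟨$⟩ʳ k ≡ y
placed-at σ e = trans (cong (σ ⟨$⟩ʳ_) (sym (toℕ-injective e))) (Perm.inverseʳ σ)

placed-range : ∀ {r} (σ : Permutation′ r) ys n → Placed σ ys n → ∀ {y} → y ∈ ys →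
  n ≤ toℕ (σ ⟨$⟩ˡ y) × toℕ (σ ⟨$⟩ˡ y) < n + length ys
placed-range σ (y ∷ ys) n (at , _) (here refl) = ≤-reflexive (sym at) , subst (_< n + suc (length ys)) (sym at) (m<m+n n z<s)
placed-range σ (y ∷ ys) n (_ , placed) {y′} (there y′∈ys) with placed-range σ ys (suc n) placed y′∈ys
... | n<p , p<end = <⇒≤ n<p , subst (toℕ (σ ⟨$⟩ˡ y′) <_) (sym (+-suc n (length ys))) p<end

placed-onto : ∀ {r} (σ : Permutation′ r) ys n → Placed σ ys n → ∀ (k : Fin r) →
  n ≤ toℕ k → toℕ k < n + length ys → ∃ λ y → y ∈ ys × σ ⟨$⟩ʳ k ≡ y
placed-onto σ [] n _ k n≤k k<n+0 = contradiction (≤-trans k<n+0 (≤-trans (≤-reflexive (+-identityʳ n)) n≤k)) (<-irrefl refl)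
placed-onto σ (y ∷ ys) n (at , placed) k n≤k k<end with toℕ k ≟ n
... | yes k≡n = y , here refl , placed-at σ (trans at (sym k≡n))
... | no k≢n with placed-onto σ ys (suc n) placed k (≤∧≢⇒< n≤k (λ e → k≢n (sym e))) (subst (toℕ k <_) (+-suc n (length ys)) k<end)
...   | y′ , y′∈ys , σk≡y′ = y′ , there y′∈ys , σk≡y′

relabel-≢ : ∀ {r} (σ : Permutation′ r) {x y} → x ≢ y → σ ⟨$⟩ʳ x ≢ σ ⟨$⟩ʳ y
relabel-≢ σ x≢y e = x≢y (trans (sym (Perm.inverseˡ σ)) (trans (cong (σ ⟨$⟩ˡ_) e) (Perm.inverseˡ σ)))

position-of : ∀ {r} (σ : Permutation′ r) {x p} → σ ⟨$⟩ʳ x ≡ p → toℕ x ≡ toℕ (σ ⟨$⟩ˡ p)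
position-of σ {x} refl = cong toℕ (sym (Perm.inverseˡ σ))

⊆?-sound : ∀ {n} (A B : Subset n) → does (A ⊆? B) ≡ true → ∀ k → k ∊ A → k ∊ B
⊆?-sound (false ∷ A) (_ ∷ B) A⊆B (suc k) k∊A = ⊆?-sound A B A⊆B k k∊A
⊆?-sound (true ∷ A) (true ∷ B) A⊆B zero _ = refl
⊆?-sound (true ∷ A) (true ∷ B) A⊆B (suc k) k∊A = ⊆?-sound A B A⊆B k k∊A

⊆?-complete : ∀ {n} (A B : Subset n) → (∀ k → k ∊ A → k ∊ B) → does (A ⊆? B) ≡ true
⊆?-complete [] [] _ = refl
⊆?-complete (false ∷ A) (_ ∷ B) A⊆B = ⊆?-complete A B (λ k → A⊆B (suc k))
⊆?-complete (true ∷ A) (false ∷ B) A⊆B with A⊆B zero refl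
... | ()
⊆?-complete (true ∷ A) (true ∷ B) A⊆B = ⊆?-complete A B (λ k → A⊆B (suc k))

⊆?-∁ : ∀ {n} (A B : Subset n) → does (A ⊆? B) ≡ does (∁ B ⊆? ∁ A)
⊆?-∁ [] [] = refl
⊆?-∁ (false ∷ A) (true ∷ B) = ⊆?-∁ A B
⊆?-∁ (false ∷ A) (false ∷ B) = ⊆?-∁ A B
⊆?-∁ (true ∷ A) (false ∷ B) = refl
⊆?-∁ (true ∷ A) (true ∷ B) = ⊆?-∁ A B

interval-∁ : ∀ {n} (A B X : Subset n) → interval A B (∁ X) ≡ interval (∁ B) (∁ A) X
interval-∁ A B X = begin
  does (A ⊆? ∁ X) ∧ does (∁ X ⊆? B)
    ≡⟨ cong₂ _∧_ (trans (⊆?-∁ A (∁ X)) (cong (λ Y → does (Y ⊆? ∁ A)) (∁-involutive X))) (⊆?-∁ (∁ X) B) ⟩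
  does (X ⊆? ∁ A) ∧ does (∁ B ⊆? ∁ (∁ X))   ≡⟨ cong (λ Y → does (X ⊆? ∁ A) ∧ does (∁ B ⊆? Y)) (∁-involutive X) ⟩
  does (X ⊆? ∁ A) ∧ does (∁ B ⊆? X)         ≡⟨ ∧-comm (does (X ⊆? ∁ A)) _ ⟩
  does (∁ B ⊆? X) ∧ does (X ⊆? ∁ A) ∎
  where open ≡-Reasoning

-- Membership in the subsets {1, …, j} and {m} of Defs (recall point k of Fin r is the number toℕ k + 1).
∊-initSeg⇒ : ∀ {r} j (k : Fin r) → k ∊ initSeg j → toℕ k < j
∊-initSeg⇒ j k k∊ = <ᵇ⇒< (toℕ k) j (true⇒T (trans (sym (lookup∘tabulate _ k)) k∊))

∊-initSeg⇐ : ∀ {r} j (k : Fin r) → toℕ k < j → k ∊ initSeg j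
∊-initSeg⇐ j k k<j = trans (lookup∘tabulate _ k) (T⇒true (<⇒<ᵇ k<j))

∊-single⇒ : ∀ {r} m (k : Fin r) → k ∊ single m → suc (toℕ k) ≡ m
∊-single⇒ m k k∊ = ≡ᵇ⇒≡ (suc (toℕ k)) m (true⇒T (trans (sym (lookup∘tabulate _ k)) k∊))

∊-single⇐ : ∀ {r} m (k : Fin r) → suc (toℕ k) ≡ m → k ∊ single m
∊-single⇐ m k e = trans (lookup∘tabulate _ k) (T⇒true (≡⇒≡ᵇ (suc (toℕ k)) m e))

-- The subset of all points but q; it shows that an arrow p → q (p ≠ q) is a real constraint.
allBut : ∀ {r} → Fin r → Subset r
allBut q = tabulate (λ k → not (does (k Finₚ.≟ q)))

arrow⇒proper : ∀ {r} {R : Arrows r} {M : Family r} → ClosedFamily R M → ∀ {p q} → p ≢ q → R p q → IsProper M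
arrow⇒proper char {p} {q} p≢q Rpq = allBut q , ¬true⇒false (λ M∋ → q∉ (proj₁ (char (allBut q)) M∋ p q Rpq p∊))
  where
  p∊ : p ∊ allBut q
  p∊ = trans (lookup∘tabulate _ p) (cong not (dec-false (p Finₚ.≟ q) p≢q))
  q∉ : ¬ q ∊ allBut q
  q∉ = false≢true (trans (lookup∘tabulate _ q) (cong not (dec-true (q Finₚ.≟ q) refl)))

Gap : ∀ {r} → ℕ → Subset r → Set
Gap j X = (∀ k → toℕ k ≤ j → k ∊ X) × (∀ k → toℕ k ≡ suc j → ¬ k ∊ X)

interval⇒gap : ∀ {r} j (X : Subset r) → interval (initSeg (suc j)) (∁ (single (suc (suc j)))) X ≡ true → Gap j X
interval⇒gap j X I∋X with ∧-elim {does (initSeg (suc j) ⊆? X)} I∋X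
... | low , high =
  (λ k k≤j → ⊆?-sound (initSeg (suc j)) X low k (∊-initSeg⇐ (suc j) k (s≤s k≤j))) ,
  (λ k k≡1+j k∊X → ∊-∁⇒ (single (suc (suc j))) k (⊆?-sound X (∁ (single (suc (suc j)))) high k k∊X)
                                                 (∊-single⇐ (suc (suc j)) k (cong suc k≡1+j)))

gap⇒interval : ∀ {r} j (X : Subset r) → Gap j X → interval (initSeg (suc j)) (∁ (single (suc (suc j)))) X ≡ true
gap⇒interval j X (full , hole) = ∧-intro
  (⊆?-complete (initSeg (suc j)) X (λ k k∊ → full k (≤-pred (∊-initSeg⇒ (suc j) k k∊))))
  (⊆?-complete X (∁ (single (suc (suc j))))
     (λ k k∊X → ∊-∁⇐ (single (suc (suc j))) k (λ k∊s → hole k (suc-injective (∊-single⇒ (suc (suc j)) k k∊s)) k∊X)))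

any-applyUpTo⇒ : ∀ (g : ℕ → Bool) f n → any g (applyUpTo f n) ≡ true → ∃ λ j → j < n × g (f j) ≡ true
any-applyUpTo⇒ g f (suc n) hit with ∨-elim {g (f zero)} hit
... | inj₁ first = zero , z<s , first
... | inj₂ later with any-applyUpTo⇒ g (λ j → f (suc j)) n later
...   | j , j<n , gj = suc j , s<s j<n , gj

any-applyUpTo⇐ : ∀ (g : ℕ → Bool) f n j → j < n → g (f j) ≡ true → any g (applyUpTo f n) ≡ true
any-applyUpTo⇐ g f (suc n) zero _ gj = ∨-introˡ gj
any-applyUpTo⇐ g f (suc n) (suc j) (s<s j<n) gj = ∨-introʳ {g (f zero)} (any-applyUpTo⇐ g (λ j → f (suc j)) n j j<n gj)

U⇒gap : ∀ {r} i (X : Subset r) → U i X ≡ true → ∃ λ j → j < i × Gap j X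
U⇒gap i X X∈U with any-applyUpTo⇒ (λ j → interval (initSeg (suc j)) (∁ (single (suc (suc j)))) X) (λ j → j) i X∈U
... | j , j<i , I∋X = j , j<i , interval⇒gap j X I∋X

gap⇒U : ∀ {r} i (X : Subset r) j → j < i → Gap j X → U i X ≡ true
gap⇒U i X j j<i gap = any-applyUpTo⇐ (λ j → interval (initSeg (suc j)) (∁ (single (suc (suc j)))) X) (λ j → j) i j j<i (gap⇒interval j X gap)

OutStar : ∀ {r} → ℕ → Arrows r
OutStar i a b = toℕ a ≡ 0 × 1 ≤ toℕ b × toℕ b ≤ i

-- L_i is the family of sets closed under the out-star 0 → 1, …, i: a set without a gap below i
-- that contains 0 contains 1, 2, …, i in turn.
Lfam-closed : ∀ {r} i → i < r → ClosedFamily (OutStar i) (Lfam {r} i)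
Lfam-closed {r} i i<r X = closed , member
  where
  closed : Lfam i X ≡ true → Closed (OutStar i) X
  closed X∈L a b (a≡0 , 1≤b , b≤i) a∊X = fill (toℕ b) b≤i b ≤-refl
    where
    noGap : ∀ j → j < i → ¬ Gap j X
    noGap j j<i gap = false≢true (not-true X∈L) (gap⇒U i X j j<i gap)
    fill : ∀ n → n ≤ i → ∀ k → toℕ k ≤ n → k ∊ X
    fill zero _ k k≤0 = subst (_∊ X) (toℕ-injective (trans a≡0 (sym (n≤0⇒n≡0 k≤0)))) a∊X
    fill (suc n) n<i k k≤1+n with toℕ k ≤? n
    ... | yes k≤n = fill n (<⇒≤ n<i) k k≤n
    ... | no k≰n with lookup X k in k∊X
    ...   | true = refl
    ...   | false = contradiction (fill n (<⇒≤ n<i) , hole) (noGap n n<i)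
      where
      hole : ∀ k′ → toℕ k′ ≡ suc n → ¬ k′ ∊ X
      hole k′ k′≡1+n k′∊X = false≢true k∊X (subst (_∊ X) (toℕ-injective (trans k′≡1+n (sym (≤-antisym k≤1+n (≰⇒> k≰n))))) k′∊X)
  member : Closed (OutStar i) X → Lfam i X ≡ true
  member closedX with U i X in X∈U
  ... | false = refl
  ... | true with U⇒gap i X X∈U
  ...   | j , j<i , full , hole = contradiction (closedX p₀ q (toℕ-fromℕ< _ , q≥1 , q≤i) (full p₀ p₀≤j)) (hole q (toℕ-fromℕ< _))
    where
    1+j<r : suc j < r
    1+j<r = ≤-trans (s≤s j<i) i<r
    p₀ q : Fin r
    p₀ = fromℕ< (≤-trans (s≤s z≤n) 1+j<r)
    q = fromℕ< 1+j<r
    p₀≤j : toℕ p₀ ≤ j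
    p₀≤j = subst (_≤ j) (sym (toℕ-fromℕ< _)) z≤n
    q≥1 : 1 ≤ toℕ q
    q≥1 = subst (1 ≤_) (sym (toℕ-fromℕ< _)) (s≤s z≤n)
    q≤i : toℕ q ≤ i
    q≤i = subst (_≤ i) (sym (toℕ-fromℕ< _)) j<i

firstPoints : ∀ {r k} → k ≤ r → Fin k → Fin r
firstPoints k≤r j = inject≤ j k≤r

firstPoints-injective : ∀ {r k} (k≤r : k ≤ r) → Injective _≡_ _≡_ (firstPoints k≤r)
firstPoints-injective k≤r = inject≤-injective k≤r k≤r _ _

allTrue : ∀ {k} → Vec Bool k → Bool
allTrue [] = true
allTrue (x ∷ v) = x ∧ allTrue v

allTrue-tabulate⇒ : ∀ {k} (f : Fin k → Bool) → allTrue (tabulate f) ≡ true → ∀ j → f j ≡ true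
allTrue-tabulate⇒ f all zero = proj₁ (∧-elim all)
allTrue-tabulate⇒ f all (suc j) = allTrue-tabulate⇒ (λ j → f (suc j)) (proj₂ (∧-elim {f zero} all)) j

allTrue-tabulate⇐ : ∀ {k} (f : Fin k → Bool) → (∀ j → f j ≡ true) → allTrue (tabulate f) ≡ true
allTrue-tabulate⇐ {zero} f _ = refl
allTrue-tabulate⇐ {suc k} f all = ∧-intro (all zero) (allTrue-tabulate⇐ (λ j → f (suc j)) (λ j → all (suc j)))

headImpliesAll : ∀ {k} → Vec Bool (suc k) → Bool
headImpliesAll (x ∷ v) = not x ∨ allTrue v

Lfam-pattern : ∀ {r} i (i<r : i < r) X → Lfam i X ≡ Pattern headImpliesAll (firstPoints i<r) X
Lfam-pattern {r} i i<r X = bool-ext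
  (λ X∈L → closed⇒pattern (proj₁ (Lfam-closed i i<r X) X∈L))
  (λ X∈P → proj₂ (Lfam-closed i i<r X) (pattern⇒closed X∈P))
  where
  p : Fin (suc i) → Fin r
  p = firstPoints i<r
  arrow : ∀ j → OutStar i (p zero) (p (suc j))
  arrow j rewrite toℕ-inject≤ (suc j) i<r = toℕ-inject≤ zero i<r , s≤s z≤n , Finₚ.toℕ<n j
  closed⇒pattern : Closed (OutStar i) X → Pattern headImpliesAll p X ≡ true
  closed⇒pattern closedX with lookup X (p zero) in p₀∊X
  ... | false = refl
  ... | true = allTrue-tabulate⇐ _ (λ j → closedX (p zero) (p (suc j)) (arrow j) p₀∊X)
  pattern⇒closed : Pattern headImpliesAll p X ≡ true → Closed (OutStar i) X
  pattern⇒closed X∈P a b (a≡0 , 1≤b , b≤i) a∊X with toℕ b in b≡ | 1≤b | b≤i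
  ... | suc m | _ | m<i = subst (_∊ X) p[1+j]≡b (allTrue-tabulate⇒ _ tail∊X j)
    where
    head∊X : p zero ∊ X
    head∊X = subst (_∊ X) (toℕ-injective (trans a≡0 (sym (toℕ-inject≤ zero i<r)))) a∊X
    tail∊X : allTrue (tabulate (λ j → lookup X (p (suc j)))) ≡ true
    tail∊X = subst (λ x → not x ∨ allTrue (tabulate (λ j → lookup X (p (suc j)))) ≡ true) head∊X X∈P
    j : Fin i
    j = fromℕ< m<i
    p[1+j]≡b : p (suc j) ≡ b
    p[1+j]≡b = toℕ-injective (trans (toℕ-inject≤ (suc j) i<r) (trans (cong suc (toℕ-fromℕ< m<i)) (sym b≡)))

count-const : ∀ k b → count k (λ _ → b) ≡ 2 ^ k * χ b
count-const zero b = sym (+-identityʳ _)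
count-const (suc k) b rewrite count-const k b = sym (trans (*-assoc 2 (2 ^ k) _) (cong (2 ^ k * χ b +_) (+-identityʳ _)))

count-allTrue : ∀ k → count k allTrue ≡ 1
count-allTrue zero = refl
count-allTrue (suc k) rewrite count-allTrue k | count-const k false | *-zeroʳ (2 ^ k) = refl

count-headImpliesAll : ∀ i → count (suc i) headImpliesAll ≡ 2 ^ i + 1
count-headImpliesAll i rewrite count-allTrue i | count-const i true | *-identityʳ (2 ^ i) = +-comm 1 (2 ^ i)

Lfam-size : ∀ {r} i → i < r → 2 ^ suc i * size (Lfam {r} i) ≡ (2 ^ i + 1) * 2 ^ r
Lfam-size {r} i i<r = begin
  2 ^ suc i * size (Lfam {r} i)                                  ≡⟨ cong (2 ^ suc i *_) (size-cong (Lfam-pattern i i<r)) ⟩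
  2 ^ suc i * size (Pattern headImpliesAll (firstPoints i<r))    ≡⟨ pattern-size (suc i) headImpliesAll _ (firstPoints-injective i<r) ⟩
  count (suc i) headImpliesAll * 2 ^ r                           ≡⟨ cong (_* 2 ^ r) (count-headImpliesAll i) ⟩
  (2 ^ i + 1) * 2 ^ r ∎
  where open ≡-Reasoning

any-cong : ∀ {A : Set} {f g : A → Bool} → (∀ x → f x ≡ g x) → ∀ xs → any f xs ≡ any g xs
any-cong f≗g [] = refl
any-cong f≗g (x ∷ xs) = cong₂ _∨_ (f≗g x) (any-cong f≗g xs)

L′fam-dual : ∀ {r} i (X : Subset r) → L′fam i X ≡ Lfam i (∁ X)
L′fam-dual i X = cong not (any-cong intervals (upTo i))
  where
  intervals : ∀ j → interval (single (suc (suc j))) (∁ (initSeg (suc j))) X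
                  ≡ interval (initSeg (suc j)) (∁ (single (suc (suc j)))) (∁ X)
  intervals j = sym (trans (interval-∁ (initSeg (suc j)) _ X)
                           (cong (λ A → interval A (∁ (initSeg (suc j))) X) (∁-involutive (single (suc (suc j))))))

L′fam-size : ∀ {r} i → i < r → 2 ^ suc i * size (L′fam {r} i) ≡ (2 ^ i + 1) * 2 ^ r
L′fam-size {r} i i<r = trans (cong (2 ^ suc i *_) (trans (size-cong (L′fam-dual {r} i)) (size-∁ (Lfam {r} i)))) (Lfam-size i i<r)

interval-single : ∀ {r} m (X : Subset r) (p q : Fin r) → toℕ p ≡ m → toℕ q ≡ suc m →
  interval (single (suc m)) (∁ (single (suc (suc m)))) X ≡ lookup X p ∧ not (lookup X q)
interval-single m X p q p≡m q≡1+m = bool-ext to from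
  where
  from : lookup X p ∧ not (lookup X q) ≡ true → interval (single (suc m)) (∁ (single (suc (suc m)))) X ≡ true
  from p∊X∌q with ∧-elim {lookup X p} p∊X∌q
  ... | p∊X , q∉X = ∧-intro
    (⊆?-complete (single (suc m)) X (λ k k∊ → subst (_∊ X) (toℕ-injective (trans p≡m (sym (suc-injective (∊-single⇒ _ k k∊))))) p∊X))
    (⊆?-complete X (∁ (single (suc (suc m))))
      (λ k k∊X → ∊-∁⇐ (single (suc (suc m))) k
        (λ k∊s → false≢true (not-true q∉X) (subst (_∊ X) (toℕ-injective (trans (suc-injective (∊-single⇒ _ k k∊s)) (sym q≡1+m))) k∊X))))
  to : interval (single (suc m)) (∁ (single (suc (suc m)))) X ≡ true → lookup X p ∧ not (lookup X q) ≡ true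
  to I∋X with ∧-elim {does (single (suc m) ⊆? X)} I∋X
  ... | low , high = ∧-intro
    (⊆?-sound (single (suc m)) X low p (∊-single⇐ (suc m) p (cong suc p≡m)))
    (not-false (¬true⇒false (λ q∊X → ∊-∁⇒ (single (suc (suc m))) q (⊆?-sound X _ high q q∊X) (∊-single⇐ (suc (suc m)) q (cong suc q≡1+m)))))

Matching : ∀ {r} → Arrows r
Matching a b = (toℕ a ≡ 0 × toℕ b ≡ 1) ⊎ (toℕ a ≡ 2 × toℕ b ≡ 3)

twoImplications : Vec Bool 4 → Bool
twoImplications (x₀ ∷ x₁ ∷ x₂ ∷ x₃ ∷ []) = not ((x₀ ∧ not x₁) ∨ (x₂ ∧ not x₃))

LV-pattern : ∀ {r} (4≤r : 4 ≤ r) X → LV {r} X ≡ Pattern twoImplications (firstPoints 4≤r) X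
LV-pattern 4≤r X = cong not (cong₂ _∨_
  (interval-single 0 X _ _ (toℕ-inject≤ 0F 4≤r) (toℕ-inject≤ 1F 4≤r))
  (interval-single 2 X _ _ (toℕ-inject≤ 2F 4≤r) (toℕ-inject≤ 3F 4≤r)))

LV-size : ∀ {r} → 4 ≤ r → 16 * size (LV {r}) ≡ 9 * 2 ^ r
LV-size 4≤r = trans (cong (16 *_) (size-cong (LV-pattern 4≤r))) (pattern-size 4 twoImplications _ (firstPoints-injective 4≤r))

LV-closed : ∀ {r} → 4 ≤ r → ClosedFamily Matching (LV {r})
LV-closed {r} 4≤r X = closed , member
  where
  p : Fin 4 → Fin r
  p = firstPoints 4≤r
  violation : Fin 4 → Fin 4 → Bool
  violation i j = lookup X (p i) ∧ not (lookup X (p j))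
  at : ∀ {a} j → toℕ a ≡ toℕ j → a ≡ p j
  at j a≡j = toℕ-injective (trans a≡j (sym (toℕ-inject≤ j 4≤r)))
  implies⇒ : ∀ a b → not (a ∧ not b) ≡ true → a ≡ true → b ≡ true
  implies⇒ true true _ _ = refl
  implies⇐ : ∀ a b → (a ≡ true → b ≡ true) → not (a ∧ not b) ≡ true
  implies⇐ true b a⇒b rewrite a⇒b refl = refl
  implies⇐ false b _ = refl
  not-∨ : ∀ a b → not (a ∨ b) ≡ not a ∧ not b
  not-∨ true b = refl
  not-∨ false b = refl
  closed : LV X ≡ true → Closed Matching X
  closed X∈LV a b arrow a∊X = follow arrow
    where
    implications : not (lookup X (p 0F) ∧ not (lookup X (p 1F))) ≡ true
                 × not (lookup X (p 2F) ∧ not (lookup X (p 3F))) ≡ true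
    implications = ∧-elim (trans (sym (not-∨ (violation 0F 1F) (violation 2F 3F))) (trans (sym (LV-pattern 4≤r X)) X∈LV))
    follow : Matching a b → b ∊ X
    follow (inj₁ (a≡0 , b≡1)) = subst (_∊ X) (sym (at 1F b≡1)) (implies⇒ _ _ (proj₁ implications) (subst (_∊ X) (at 0F a≡0) a∊X))
    follow (inj₂ (a≡2 , b≡3)) = subst (_∊ X) (sym (at 3F b≡3)) (implies⇒ _ _ (proj₂ implications) (subst (_∊ X) (at 2F a≡2) a∊X))
  member : Closed Matching X → LV X ≡ true
  member closedX = trans (LV-pattern 4≤r X) (trans (not-∨ (violation 0F 1F) (violation 2F 3F)) (∧-intro
    (implies⇐ _ _ (closedX (p 0F) (p 1F) (inj₁ (toℕ-inject≤ 0F 4≤r , toℕ-inject≤ 1F 4≤r))))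
    (implies⇐ _ _ (closedX (p 2F) (p 3F) (inj₂ (toℕ-inject≤ 2F 4≤r , toℕ-inject≤ 3F 4≤r))))))

dual : ∀ {r} → Family r → Family r
dual L X = L (∁ X)

dual-dual : ∀ {r} (L : Family r) X → dual (dual L) X ≡ L X
dual-dual L X = cong L (∁-involutive X)

∁-∪ : ∀ {n} (X Y : Subset n) → ∁ (X ∪ Y) ≡ ∁ X ∩ ∁ Y
∁-∪ [] [] = refl
∁-∪ (true ∷ X) (y ∷ Y) = cong (false ∷_) (∁-∪ X Y)
∁-∪ (false ∷ X) (y ∷ Y) = cong (not y ∷_) (∁-∪ X Y)

∁-∩ : ∀ {n} (X Y : Subset n) → ∁ (X ∩ Y) ≡ ∁ X ∪ ∁ Y
∁-∩ [] [] = refl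
∁-∩ (true ∷ X) (y ∷ Y) = cong (not y ∷_) (∁-∩ X Y)
∁-∩ (false ∷ X) (y ∷ Y) = cong (true ∷_) (∁-∩ X Y)

dual-sublattice : ∀ {r} (L : Family r) → IsSublattice L → IsSublattice (dual L)
dual-sublattice L ((X , LX) , ∪-closed , ∩-closed) =
  (∁ X , trans (dual-dual L X) LX) ,
  (λ X Y LX LY → subst (λ Z → L Z ≡ true) (sym (∁-∪ X Y)) (∩-closed (∁ X) (∁ Y) LX LY)) ,
  (λ X Y LX LY → subst (λ Z → L Z ≡ true) (sym (∁-∩ X Y)) (∪-closed (∁ X) (∁ Y) LX LY))

dual-proper : ∀ {r} (L : Family r) → IsProper L → IsProper (dual L)
dual-proper L (X , X∉L) = ∁ X , trans (dual-dual L X) X∉L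

dual-large : ∀ {r} (L : Family r) → Large L → Large (dual L)
dual-large {r} L big = subst (λ n → 2 ^ r < 2 * n) (sym (size-∁ L)) big

act-∁ : ∀ {r} (σ : Permutation′ r) X → actSub σ (∁ X) ≡ ∁ (actSub σ X)
act-∁ σ X = subset-ext (λ y → trans (lookup-act σ (∁ X) y)
  (trans (lookup-∁ X (σ ⟨$⟩ˡ y)) (sym (trans (lookup-∁ (actSub σ X) y) (cong not (lookup-act σ X y))))))

dual-≅ : ∀ {r} {L M : Family r} σ → L ≅[ σ ] M → dual L ≅[ σ ] dual M
dual-≅ {L = L} σ L≅M X = trans (cong L (sym (act-∁ σ X))) (L≅M (∁ X))

Implications : ∀ {k} → List (Fin k × Fin k) → Vec Bool k → Bool
Implications [] v = true
Implications ((i , j) ∷ A) v = (not (lookup v i) ∨ lookup v j) ∧ Implications A v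

by-computation : ∀ {m n} {m≤n : True (m ≤? n)} → m ≤ n
by-computation {m≤n = m≤n} = toWitness m≤n

module LargeSublattice {r} (L : Family r) (sublattice : IsSublattice L) (large : Large L) where

  ∪-closed : ∪-Closed L
  ∪-closed = proj₁ (proj₂ sublattice)

  ∩-closed : ∩-Closed L
  ∩-closed = proj₂ (proj₂ sublattice)

  open Birkhoff L ∪-closed ∩-closed (large-∋⊥ L ∩-closed large) (large-∋⊤ L ∪-closed large) public

  -- A configuration of arrows between distinct points whose implication pattern has density
  -- at most 1/2 cannot occur in L: L would lie inside that pattern.
  sparse-configuration : ∀ (c : List (Fin r)) → Unique c → (A : List (Fin (length c) × Fin (length c))) →
    All (λ ij → List.lookup c (proj₁ ij) ⇝ List.lookup c (proj₂ ij)) A →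
    2 * count (length c) (Implications A) ≤ 2 ^ length c → Empty
  sparse-configuration c distinct A arrows sparse =
    <⇒≱ large (pattern-bound (length c) (Implications A) (List.lookup c) (unique-lookup-injective distinct _ _) L
                 (λ X LX → respected X LX A arrows) sparse)
    where
    respected : ∀ X → L X ≡ true → ∀ A′ → All (λ ij → List.lookup c (proj₁ ij) ⇝ List.lookup c (proj₂ ij)) A′ →
      Pattern (Implications A′) (List.lookup c) X ≡ true
    respected X LX [] [] = refl
    respected X LX ((i , j) ∷ A′) (i⇝j ∷ arrows′) = ∧-intro implication (respected X LX A′ arrows′)
      where
      implication : not (lookup (tabulate (λ k → lookup X (List.lookup c k))) i) ∨ lookup (tabulate (λ k → lookup X (List.lookup c k))) j ≡ true
      implication rewrite lookup∘tabulate (λ k → lookup X (List.lookup c k)) i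
                        | lookup∘tabulate (λ k → lookup X (List.lookup c k)) j
                        with lookup X (List.lookup c i) in i∊X
      ... | false = refl
      ... | true = ⇝-elim i⇝j X LX i∊X

  -- No 2-cycle a ⇄ b (density 2/4) and no path a → b → c (density 4/8).
  no-cycle : ∀ {a b} → a ≢ b → a ⇝ b → b ⇝ a → Empty
  no-cycle a≢b a⇝b b⇝a = sparse-configuration (_ ∷ _ ∷ []) ((a≢b ∷ []) ∷ [] ∷ [])
    ((0F , 1F) ∷ (1F , 0F) ∷ []) (a⇝b ∷ b⇝a ∷ []) by-computation

  no-path : ∀ {a b c} → a ≢ b → a ≢ c → b ≢ c → a ⇝ b → b ⇝ c → Empty
  no-path a≢b a≢c b≢c a⇝b b⇝c = sparse-configuration (_ ∷ _ ∷ _ ∷ []) ((a≢b ∷ a≢c ∷ []) ∷ (b≢c ∷ []) ∷ [] ∷ [])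
    ((0F , 1F) ∷ (1F , 2F) ∷ []) (a⇝b ∷ b⇝c ∷ []) by-computation

  -- Two disjoint arrows a → b, c → d admit no third arrow: the configurations below have
  -- densities 8/16, 15/32, 15/32 and 27/64.
  no-source-to-other-target : ∀ {a b c d : Fin r} → Unique (a ∷ b ∷ c ∷ d ∷ []) → a ⇝ b → c ⇝ d → a ⇝ d → Empty
  no-source-to-other-target distinct a⇝b c⇝d a⇝d = sparse-configuration _ distinct
    ((0F , 1F) ∷ (2F , 3F) ∷ (0F , 3F) ∷ []) (a⇝b ∷ c⇝d ∷ a⇝d ∷ []) by-computation

  no-shared-source : ∀ {a b c d x : Fin r} → Unique (a ∷ b ∷ c ∷ d ∷ x ∷ []) → a ⇝ b → c ⇝ d → a ⇝ x → Empty
  no-shared-source distinct a⇝b c⇝d a⇝x = sparse-configuration _ distinct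
    ((0F , 1F) ∷ (2F , 3F) ∷ (0F , 4F) ∷ []) (a⇝b ∷ c⇝d ∷ a⇝x ∷ []) by-computation

  no-shared-target : ∀ {a b c d x : Fin r} → Unique (a ∷ b ∷ c ∷ d ∷ x ∷ []) → a ⇝ b → c ⇝ d → x ⇝ b → Empty
  no-shared-target distinct a⇝b c⇝d x⇝b = sparse-configuration _ distinct
    ((0F , 1F) ∷ (2F , 3F) ∷ (4F , 1F) ∷ []) (a⇝b ∷ c⇝d ∷ x⇝b ∷ []) by-computation

  no-third-matching-edge : ∀ {a b c d x y : Fin r} → Unique (a ∷ b ∷ c ∷ d ∷ x ∷ y ∷ []) → a ⇝ b → c ⇝ d → x ⇝ y → Empty
  no-third-matching-edge distinct a⇝b c⇝d x⇝y = sparse-configuration _ distinct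
    ((0F , 1F) ∷ (2F , 3F) ∷ (4F , 5F) ∷ []) (a⇝b ∷ c⇝d ∷ x⇝y ∷ []) by-computation

  -- Two arrows between distinct points share their source, share their target, or are disjoint
  -- (a common point in any other position would make a cycle or a path).
  Disjoint : Fin r → Fin r → Fin r → Fin r → Set
  Disjoint a b p q = p ≢ a × p ≢ b × q ≢ a × q ≢ b

  two-arrows : ∀ {a b p q} → a ≢ b → a ⇝ b → p ≢ q → p ⇝ q → p ≡ a ⊎ q ≡ b ⊎ Disjoint a b p q
  two-arrows {a} {b} {p} {q} a≢b a⇝b p≢q p⇝q with p Finₚ.≟ a | q Finₚ.≟ b
  ... | yes p≡a | _ = inj₁ p≡a
  ... | no _ | yes q≡b = inj₂ (inj₁ q≡b)
  ... | no p≢a | no q≢b with p Finₚ.≟ b | q Finₚ.≟ a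
  ...   | yes refl | yes refl = ⊥-elim (no-cycle a≢b a⇝b p⇝q)
  ...   | yes refl | no q≢a = ⊥-elim (no-path a≢b (≢-sym q≢a) p≢q a⇝b p⇝q)
  ...   | no p≢b | yes refl = ⊥-elim (no-path p≢q p≢b a≢b p⇝q a⇝b)
  ...   | no p≢b | no q≢a = inj₂ (inj₂ (p≢a , p≢b , q≢a , q≢b))

  inequalities : ∀ {a b c d : Fin r} → Unique (a ∷ b ∷ c ∷ d ∷ []) → a ≢ b × a ≢ c × a ≢ d × b ≢ c × b ≢ d × c ≢ d
  inequalities ((a≢b ∷ a≢c ∷ a≢d ∷ []) ∷ (b≢c ∷ b≢d ∷ []) ∷ (c≢d ∷ []) ∷ [] ∷ []) = a≢b , a≢c , a≢d , b≢c , b≢d , c≢d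

  swap-pairs : ∀ {a b c d : Fin r} → Unique (a ∷ b ∷ c ∷ d ∷ []) → Unique (c ∷ d ∷ a ∷ b ∷ [])
  swap-pairs ((a≢b ∷ a≢c ∷ a≢d ∷ []) ∷ (b≢c ∷ b≢d ∷ []) ∷ (c≢d ∷ []) ∷ [] ∷ []) =
    (c≢d ∷ ≢-sym a≢c ∷ ≢-sym b≢c ∷ []) ∷ (≢-sym a≢d ∷ ≢-sym b≢d ∷ []) ∷ (a≢b ∷ []) ∷ [] ∷ []

  same-source : ∀ {a b c d : Fin r} → Unique (a ∷ b ∷ c ∷ d ∷ []) → a ⇝ b → c ⇝ d →
    ∀ {q} → a ≢ q → a ⇝ q → q ≢ c → q ≢ d → q ≡ b
  same-source {b = b} ((a≢b ∷ a≢c ∷ a≢d ∷ []) ∷ (b≢c ∷ b≢d ∷ []) ∷ (c≢d ∷ []) ∷ [] ∷ []) a⇝b c⇝d {q} a≢q a⇝q q≢c q≢d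
    with q Finₚ.≟ b
  ... | yes q≡b = q≡b
  ... | no q≢b = ⊥-elim (no-shared-source
    ((a≢b ∷ a≢c ∷ a≢d ∷ a≢q ∷ []) ∷ (b≢c ∷ b≢d ∷ ≢-sym q≢b ∷ []) ∷ (c≢d ∷ ≢-sym q≢c ∷ []) ∷ (≢-sym q≢d ∷ []) ∷ [] ∷ [])
    a⇝b c⇝d a⇝q)

  same-target : ∀ {a b c d : Fin r} → Unique (a ∷ b ∷ c ∷ d ∷ []) → a ⇝ b → c ⇝ d →
    ∀ {p} → p ≢ b → p ⇝ b → p ≢ c → p ≢ d → p ≡ a
  same-target {a = a} ((a≢b ∷ a≢c ∷ a≢d ∷ []) ∷ (b≢c ∷ b≢d ∷ []) ∷ (c≢d ∷ []) ∷ [] ∷ []) a⇝b c⇝d {p} p≢b p⇝b p≢c p≢d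
    with p Finₚ.≟ a
  ... | yes p≡a = p≡a
  ... | no p≢a = ⊥-elim (no-shared-target
    ((a≢b ∷ a≢c ∷ a≢d ∷ ≢-sym p≢a ∷ []) ∷ (b≢c ∷ b≢d ∷ ≢-sym p≢b ∷ []) ∷ (c≢d ∷ ≢-sym p≢c ∷ []) ∷ (≢-sym p≢d ∷ []) ∷ [] ∷ [])
    a⇝b c⇝d p⇝b)

  matching-rigid : ∀ {a b c d : Fin r} → Unique (a ∷ b ∷ c ∷ d ∷ []) → a ⇝ b → c ⇝ d →
    ∀ {p q} → p ≢ q → p ⇝ q → (p ≡ a × q ≡ b) ⊎ (p ≡ c × q ≡ d)
  matching-rigid distinct a⇝b c⇝d p≢q p⇝q
    with inequalities distinct | two-arrows (proj₁ (inequalities distinct)) a⇝b p≢q p⇝q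
                               | two-arrows (proj₂ (proj₂ (proj₂ (proj₂ (proj₂ (inequalities distinct)))))) c⇝d p≢q p⇝q
  ... | (_ , a≢c , _) | inj₁ refl | inj₁ refl = ⊥-elim (a≢c refl)
  ... | _ | inj₁ refl | inj₂ (inj₁ refl) = ⊥-elim (no-source-to-other-target distinct a⇝b c⇝d p⇝q)
  ... | _ | inj₁ refl | inj₂ (inj₂ (_ , _ , q≢c , q≢d)) = inj₁ (refl , same-source distinct a⇝b c⇝d p≢q p⇝q q≢c q≢d)
  ... | _ | inj₂ (inj₁ refl) | inj₁ refl = ⊥-elim (no-source-to-other-target (swap-pairs distinct) c⇝d a⇝b p⇝q)
  ... | (_ , _ , _ , _ , b≢d , _) | inj₂ (inj₁ refl) | inj₂ (inj₁ refl) = ⊥-elim (b≢d refl)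
  ... | _ | inj₂ (inj₁ refl) | inj₂ (inj₂ (p≢c , p≢d , _ , _)) = inj₁ (same-target distinct a⇝b c⇝d p≢q p⇝q p≢c p≢d , refl)
  ... | _ | inj₂ (inj₂ (p≢a , p≢b , q≢a , q≢b)) | inj₁ refl = inj₂ (refl , same-source (swap-pairs distinct) c⇝d a⇝b p≢q p⇝q q≢a q≢b)
  ... | _ | inj₂ (inj₂ (p≢a , p≢b , q≢a , q≢b)) | inj₂ (inj₁ refl) = inj₂ (same-target (swap-pairs distinct) c⇝d a⇝b p≢q p⇝q p≢a p≢b , refl)
  ... | (a≢b , a≢c , a≢d , b≢c , b≢d , c≢d) | inj₂ (inj₂ (p≢a , p≢b , q≢a , q≢b)) | inj₂ (inj₂ (p≢c , p≢d , q≢c , q≢d)) =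
    ⊥-elim (no-third-matching-edge
      ((a≢b ∷ a≢c ∷ a≢d ∷ ≢-sym p≢a ∷ ≢-sym q≢a ∷ []) ∷ (b≢c ∷ b≢d ∷ ≢-sym p≢b ∷ ≢-sym q≢b ∷ []) ∷
       (c≢d ∷ ≢-sym p≢c ∷ ≢-sym q≢c ∷ []) ∷ (≢-sym p≢d ∷ ≢-sym q≢d ∷ []) ∷ (p≢q ∷ []) ∷ [] ∷ [])
      a⇝b c⇝d p⇝q)

  -- If all arrows leave a, then placing a first and its targets next makes L a conjugate of L_i,
  -- i being the number of targets.
  out-star : ∀ {a b} → a ≢ b → a ⇝ b → (∀ {p q} → p ≢ q → p ⇝ q → p ≡ a) →
    ∃ λ (σ : Permutation′ r) → ∃ λ i → 1 ≤ i × i < r × L ≅[ σ ] Lfam i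
  out-star {a} {b} a≢b a⇝b leaves-a = σ , i , 1≤i , i<r , conjugate σ birkhoff (Lfam-closed i i<r) (to , from)
    where
    IsTarget : Fin r → Set
    IsTarget y = y ≢ a × a ⇝ y
    target? : Unary.Decidable IsTarget
    target? y = ¬? (y Finₚ.≟ a) ×-dec (a ⇝? y)
    targets : List (Fin r)
    targets = List.filter target? (List.allFin r)
    target⇒ : ∀ {y} → y ∈ targets → IsTarget y
    target⇒ y∈ = proj₂ (∈-filter⁻ target? {xs = List.allFin r} y∈)
    target⇐ : ∀ {y} → y ≢ a → a ⇝ y → y ∈ targets
    target⇐ {y} y≢a a⇝y = ∈-filter⁺ target? (∈-allFin y) (y≢a , a⇝y)
    distinct : Unique (a ∷ targets)
    distinct = All.tabulate (λ y∈ a≡y → proj₁ (target⇒ y∈) (sym a≡y)) ∷ filter⁺ target? (allFin⁺ r)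
    i : ℕ
    i = length targets
    1≤i : 1 ≤ i
    1≤i with targets | target⇐ (≢-sym a≢b) a⇝b
    ... | _ ∷ _ | _ = s≤s z≤n
    i<r : i < r
    i<r = unique-length distinct
    placement : Σ (Permutation′ r) (λ σ → Placed σ (a ∷ targets) 0)
    placement = place (a ∷ targets) 0 distinct i<r
    σ : Permutation′ r
    σ = proj₁ placement
    a-at-0 : toℕ (σ ⟨$⟩ˡ a) ≡ 0
    a-at-0 = proj₁ (proj₂ placement)
    to : ∀ x y → x ≢ y → (_⇝_ along σ) x y → OutStar i x y
    to x y x≢y σx⇝σy = trans (position-of σ σx≡a) a-at-0 , 1≤y , ≤-pred y<1+i
      where
      σx≡a : σ ⟨$⟩ʳ x ≡ a
      σx≡a = leaves-a (relabel-≢ σ x≢y) σx⇝σy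
      σy∈ : σ ⟨$⟩ʳ y ∈ targets
      σy∈ = target⇐ (λ σy≡a → relabel-≢ σ x≢y (trans σx≡a (sym σy≡a))) (subst (_⇝ σ ⟨$⟩ʳ y) σx≡a σx⇝σy)
      range : 1 ≤ toℕ (σ ⟨$⟩ˡ (σ ⟨$⟩ʳ y)) × toℕ (σ ⟨$⟩ˡ (σ ⟨$⟩ʳ y)) < 1 + i
      range = placed-range σ targets 1 (proj₂ (proj₂ placement)) σy∈
      1≤y : 1 ≤ toℕ y
      1≤y = subst (1 ≤_) (sym (position-of σ refl)) (proj₁ range)
      y<1+i : toℕ y < suc i
      y<1+i = subst (_< suc i) (sym (position-of σ refl)) (proj₂ range)
    from : ∀ x y → x ≢ y → OutStar i x y → (_⇝_ along σ) x y
    from x y x≢y (x≡0 , 1≤y , y≤i) with placed-onto σ targets 1 (proj₂ (proj₂ placement)) y 1≤y (s≤s y≤i)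
    ... | t , t∈ , σy≡t = subst₂ _⇝_ (sym (placed-at σ (trans a-at-0 (sym x≡0)))) (sym σy≡t) (proj₂ (target⇒ t∈))

  -- Two disjoint arrows: placing them at 0 → 1 and 2 → 3 makes L a conjugate of L_V.
  matching-case : ∀ {a b c d : Fin r} → Unique (a ∷ b ∷ c ∷ d ∷ []) → a ⇝ b → c ⇝ d →
    ∃ λ (σ : Permutation′ r) → 4 ≤ r × L ≅[ σ ] LV
  matching-case {a} {b} {c} {d} distinct a⇝b c⇝d = σ , 4≤r , conjugate σ birkhoff (LV-closed 4≤r) (to , from)
    where
    4≤r : 4 ≤ r
    4≤r = unique-length distinct
    placement : Σ (Permutation′ r) (λ σ → Placed σ (a ∷ b ∷ c ∷ d ∷ []) 0)
    placement = place (a ∷ b ∷ c ∷ d ∷ []) 0 distinct 4≤r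
    σ : Permutation′ r
    σ = proj₁ placement
    at-a : toℕ (σ ⟨$⟩ˡ a) ≡ 0
    at-a = proj₁ (proj₂ placement)
    at-b : toℕ (σ ⟨$⟩ˡ b) ≡ 1
    at-b = proj₁ (proj₂ (proj₂ placement))
    at-c : toℕ (σ ⟨$⟩ˡ c) ≡ 2
    at-c = proj₁ (proj₂ (proj₂ (proj₂ placement)))
    at-d : toℕ (σ ⟨$⟩ˡ d) ≡ 3
    at-d = proj₁ (proj₂ (proj₂ (proj₂ (proj₂ placement))))
    to : ∀ x y → x ≢ y → (_⇝_ along σ) x y → Matching x y
    to x y x≢y σx⇝σy with matching-rigid distinct a⇝b c⇝d (relabel-≢ σ x≢y) σx⇝σy
    ... | inj₁ (σx≡a , σy≡b) = inj₁ (trans (position-of σ σx≡a) at-a , trans (position-of σ σy≡b) at-b)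
    ... | inj₂ (σx≡c , σy≡d) = inj₂ (trans (position-of σ σx≡c) at-c , trans (position-of σ σy≡d) at-d)
    from : ∀ x y → x ≢ y → Matching x y → (_⇝_ along σ) x y
    from x y _ (inj₁ (x≡0 , y≡1)) =
      subst₂ _⇝_ (sym (placed-at σ (trans at-a (sym x≡0)))) (sym (placed-at σ (trans at-b (sym y≡1)))) a⇝b
    from x y _ (inj₂ (x≡2 , y≡3)) =
      subst₂ _⇝_ (sym (placed-at σ (trans at-c (sym x≡2)))) (sym (placed-at σ (trans at-d (sym y≡3)))) c⇝d

  no-arrow⇒full : (∀ a b → a ≢ b → ¬ a ⇝ b) → ∀ X → L X ≡ true
  no-arrow⇒full none X = closed⇒member X (closed-transfer none X (λ _ _ ()))

  NoArrowDisjointFrom : Fin r → Fin r → Set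
  NoArrowDisjointFrom a b = ∀ {p q} → p ≢ q → p ⇝ q → ¬ Disjoint a b p q

  meets : ∀ {a b} → a ≢ b → a ⇝ b → NoArrowDisjointFrom a b → ∀ {p q} → p ≢ q → p ⇝ q → p ≡ a ⊎ q ≡ b
  meets a≢b a⇝b no-disjoint p≢q p⇝q with two-arrows a≢b a⇝b p≢q p⇝q
  ... | inj₁ p≡a = inj₁ p≡a
  ... | inj₂ (inj₁ q≡b) = inj₂ q≡b
  ... | inj₂ (inj₂ disjoint) = ⊥-elim (no-disjoint p≢q p⇝q disjoint)

  -- If moreover some x ∉ {a, b} has x → b, every arrow ends at b: an arrow a → q with q ≠ b
  -- would be disjoint from x → b, and a → b would be a third arrow.
  into-b : ∀ {a b x} → a ≢ b → a ⇝ b → NoArrowDisjointFrom a b → x ≢ a → x ≢ b → x ⇝ b →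
    ∀ {p q} → p ≢ q → p ⇝ q → q ≡ b
  into-b {a} {b} {x} a≢b a⇝b no-disjoint x≢a x≢b x⇝b {p} {q} p≢q p⇝q with meets a≢b a⇝b no-disjoint p≢q p⇝q
  ... | inj₂ q≡b = q≡b
  ... | inj₁ refl with q Finₚ.≟ b | q Finₚ.≟ x
  ...   | yes q≡b | _ = q≡b
  ...   | no q≢b | yes refl = ⊥-elim (no-path p≢q a≢b x≢b p⇝q x⇝b)
  ...   | no q≢b | no q≢x with matching-rigid
            ((p≢q ∷ ≢-sym x≢a ∷ a≢b ∷ []) ∷ (q≢x ∷ q≢b ∷ []) ∷ (x≢b ∷ []) ∷ [] ∷ []) p⇝q x⇝b a≢b a⇝b
  ...     | inj₁ (_ , b≡q) = ⊥-elim (q≢b (sym b≡q))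
  ...     | inj₂ (a≡x , _) = ⊥-elim (x≢a (sym a≡x))

  out-of-a : ∀ {a b} → a ≢ b → a ⇝ b → NoArrowDisjointFrom a b → (∀ x → x ≢ a → x ≢ b → ¬ x ⇝ b) →
    ∀ {p q} → p ≢ q → p ⇝ q → p ≡ a
  out-of-a {a} a≢b a⇝b no-disjoint no-other-source {p} p≢q p⇝q with meets a≢b a⇝b no-disjoint p≢q p⇝q
  ... | inj₁ p≡a = p≡a
  ... | inj₂ refl with p Finₚ.≟ a
  ...   | yes p≡a = p≡a
  ...   | no p≢a = ⊥-elim (no-other-source p p≢a p≢q p⇝q)

  data Shape : Set where
    out-shape : ∀ {a b} → a ≢ b → a ⇝ b → (∀ {p q} → p ≢ q → p ⇝ q → p ≡ a) → Shape
    in-shape : ∀ {a b} → a ≢ b → a ⇝ b → (∀ {p q} → p ≢ q → p ⇝ q → q ≡ b) → Shape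
    matching-shape : ∀ {a b c d : Fin r} → Unique (a ∷ b ∷ c ∷ d ∷ []) → a ⇝ b → c ⇝ d → Shape

  shape : IsProper L → Shape
  shape (X , X∉L) with Finₚ.any? (λ a → Finₚ.any? (λ b → ¬? (a Finₚ.≟ b) ×-dec (a ⇝? b)))
  ... | no no-arrow = ⊥-elim (false≢true X∉L (no-arrow⇒full (λ a b a≢b a⇝b → no-arrow (a , b , a≢b , a⇝b)) X))
  ... | yes (a , b , a≢b , a⇝b)
    with Finₚ.any? (λ c → Finₚ.any? (λ d → ¬? (c Finₚ.≟ d) ×-dec (c ⇝? d) ×-dec
                     ¬? (c Finₚ.≟ a) ×-dec ¬? (c Finₚ.≟ b) ×-dec ¬? (d Finₚ.≟ a) ×-dec ¬? (d Finₚ.≟ b)))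
  ...   | yes (c , d , c≢d , c⇝d , c≢a , c≢b , d≢a , d≢b) =
    matching-shape ((a≢b ∷ ≢-sym c≢a ∷ ≢-sym d≢a ∷ []) ∷ (≢-sym c≢b ∷ ≢-sym d≢b ∷ []) ∷ (c≢d ∷ []) ∷ [] ∷ []) a⇝b c⇝d
  ...   | no no-disjoint with Finₚ.any? (λ x → ¬? (x Finₚ.≟ a) ×-dec ¬? (x Finₚ.≟ b) ×-dec (x ⇝? b))
  ...     | yes (x , x≢a , x≢b , x⇝b) =
    in-shape a≢b a⇝b (into-b a≢b a⇝b (λ p≢q p⇝q disjoint → no-disjoint (_ , _ , p≢q , p⇝q , disjoint)) x≢a x≢b x⇝b)
  ...     | no no-other-source = out-shape a≢b a⇝b (out-of-a a≢b a⇝b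
    (λ p≢q p⇝q disjoint → no-disjoint (_ , _ , p≢q , p⇝q , disjoint)) (λ x x≢a x≢b x⇝b → no-other-source (x , x≢a , x≢b , x⇝b)))

Standard : ∀ {r} → Family r → Set
Standard {r} L = ∃ λ (σ : Permutation′ r) →
  (∃ λ i → 1 ≤ i × i < r × L ≅[ σ ] Lfam i) ⊎ (∃ λ i → 1 ≤ i × i < r × L ≅[ σ ] L′fam i) ⊎ (4 ≤ r × L ≅[ σ ] LV)

LargeProperSublattice : ∀ {r} → Family r → Set
LargeProperSublattice L = IsSublattice L × IsProper L × Large L

-- An in-star of L is an out-star of its dual; so a large sublattice whose arrows all end at b
-- is a conjugate of some L′_i.
module Duality {r} (L : Family r) (sublattice : IsSublattice L) (large : Large L) where
  module Primal = LargeSublattice L sublattice large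
  module Opposite = LargeSublattice (dual L) (dual-sublattice L sublattice) (dual-large L large)

  dual-arrow⇒ : ∀ {p q} → p Opposite.⇝ q → q Primal.⇝ p
  dual-arrow⇒ {p} {q} p⇝q = Primal.⇝-intro above
    where
    above : ∀ Y → L Y ≡ true → q ∊ Y → p ∊ Y
    above Y LY q∊Y with lookup Y p in p∊Y
    ... | true = refl
    ... | false = ⊥-elim (∊-∁⇒ Y q (Opposite.⇝-elim p⇝q (∁ Y) (trans (dual-dual L Y) LY) (∊-∁⇐ Y p (false≢true p∊Y))) q∊Y)

  dual-arrow⇐ : ∀ {p q} → q Primal.⇝ p → p Opposite.⇝ q
  dual-arrow⇐ {p} {q} q⇝p = Opposite.⇝-intro above
    where
    above : ∀ Y → dual L Y ≡ true → p ∊ Y → q ∊ Y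
    above Y L∁Y p∊Y with lookup Y q in q∊Y
    ... | true = refl
    ... | false = ⊥-elim (∊-∁⇒ Y p (Primal.⇝-elim q⇝p (∁ Y) L∁Y (∊-∁⇐ Y q (false≢true q∊Y))) p∊Y)

  in-star : ∀ {a b} → a ≢ b → a Primal.⇝ b → (∀ {p q} → p ≢ q → p Primal.⇝ q → q ≡ b) →
    ∃ λ (σ : Permutation′ r) → ∃ λ i → 1 ≤ i × i < r × L ≅[ σ ] L′fam i
  in-star {a} {b} a≢b a⇝b ends-at-b = conclude (Opposite.out-star (≢-sym a≢b) (dual-arrow⇐ a⇝b) leaves-b)
    where
    leaves-b : ∀ {p q} → p ≢ q → p Opposite.⇝ q → p ≡ b
    leaves-b {p} {q} p≢q p⇝q = ends-at-b {q} {p} (≢-sym p≢q) (dual-arrow⇒ {p} {q} p⇝q)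
    conclude : (∃ λ (σ : Permutation′ r) → ∃ λ i → 1 ≤ i × i < r × dual L ≅[ σ ] Lfam i) →
      ∃ λ (σ : Permutation′ r) → ∃ λ i → 1 ≤ i × i < r × L ≅[ σ ] L′fam i
    conclude (σ , i , 1≤i , i<r , dual≅Lᵢ) = σ , i , 1≤i , i<r , L≅L′ᵢ
      where
      L≅L′ᵢ : L ≅[ σ ] L′fam i
      L≅L′ᵢ X = trans (sym (dual-dual L (actSub σ X))) (trans (dual-≅ {L = dual L} σ dual≅Lᵢ X) (sym (L′fam-dual i X)))

classify : ∀ {r} (L : Family r) → LargeProperSublattice L → Standard L
classify {r} L (sublattice , proper , large) = from-shape (shape proper)
  where
  open LargeSublattice L sublattice large
  from-shape : Shape → Standard L
  from-shape (out-shape a≢b a⇝b leaves-a) = map₂ inj₁ (out-star a≢b a⇝b leaves-a)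
  from-shape (in-shape a≢b a⇝b ends-at-b) = map₂ (λ x → inj₂ (inj₁ x)) (Duality.in-star L sublattice large a≢b a⇝b ends-at-b)
  from-shape (matching-shape distinct a⇝b c⇝d) = map₂ (λ x → inj₂ (inj₂ x)) (matching-case distinct a⇝b c⇝d)

conjugate-of-dense : ∀ {r} {L M : Family r} {S : Arrows r} (σ : Permutation′ r) → L ≅[ σ ] M →
  ClosedFamily S M → IsProper M → ∀ {k} (P : Vec Bool k → Bool) (c : Fin k → Fin r) → Injective _≡_ _≡_ c →
  (∀ X → M X ≡ Pattern P c X) → 2 ^ k < 2 * count k P → LargeProperSublattice L
conjugate-of-dense {r} {L} {M} σ L≅M charM (X , X∉M) {k} P c injective M≡P dense =
  closedFamily-sublattice _ L (conjugate-closed σ L≅M charM) ,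
  (actSub σ X , trans (L≅M X) X∉M) ,
  subst (λ n → 2 ^ r < 2 * n) (sym (size-cong L≡P)) (pattern-large k P σc σc-injective dense)
  where
  σc : Fin k → Fin r
  σc j = σ ⟨$⟩ʳ c j
  σc-injective : Injective _≡_ _≡_ σc
  σc-injective e = injective (trans (sym (Perm.inverseˡ σ)) (trans (cong (σ ⟨$⟩ˡ_) e) (Perm.inverseˡ σ)))
  L≡P : ∀ Y → L Y ≡ Pattern P σc Y
  L≡P Y = begin
    L Y                                         ≡⟨ cong L (sym (act-flip σ Y)) ⟩
    L (actSub σ (actSub (Perm.flip σ) Y))       ≡⟨ L≅M _ ⟩
    M (actSub (Perm.flip σ) Y)                  ≡⟨ M≡P _ ⟩
    Pattern P c (actSub (Perm.flip σ) Y)        ≡⟨ cong P (tabulate-cong (λ j → lookup-act (Perm.flip σ) Y (c j))) ⟩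
    Pattern P σc Y ∎
    where open ≡-Reasoning

-- Conjugates of L_i (1 ≤ i < r) are large proper sublattices; L_i has the arrow 0 → 1.
Lfam-conjugate : ∀ {r} {L : Family r} (σ : Permutation′ r) i → 1 ≤ i → i < r → L ≅[ σ ] Lfam i → LargeProperSublattice L
Lfam-conjugate {r} σ i 1≤i i<r L≅Lᵢ =
  conjugate-of-dense σ L≅Lᵢ (Lfam-closed i i<r) (arrow⇒proper (Lfam-closed i i<r) p₀≢p₁ arrow)
    headImpliesAll (firstPoints i<r) (firstPoints-injective i<r) (Lfam-pattern i i<r) dense
  where
  p₀ p₁ : Fin r
  p₀ = fromℕ< (≤-trans (s≤s z≤n) i<r)
  p₁ = fromℕ< (≤-trans (s≤s 1≤i) i<r)
  p₀≢p₁ : p₀ ≢ p₁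
  p₀≢p₁ e with trans (sym (toℕ-fromℕ< _)) (trans (cong toℕ e) (toℕ-fromℕ< _))
  ... | ()
  arrow : OutStar i p₀ p₁
  arrow = toℕ-fromℕ< _ , ≤-reflexive (sym (toℕ-fromℕ< _)) , subst (_≤ i) (sym (toℕ-fromℕ< _)) 1≤i
  dense : 2 ^ suc i < 2 * count (suc i) headImpliesAll
  dense rewrite count-headImpliesAll i = *-monoʳ-< 2 (subst (2 ^ i <_) (+-comm 1 (2 ^ i)) ≤-refl)

-- Conjugates of L_V are large proper sublattices; L_V has the arrow 0 → 1.
LV-conjugate : ∀ {r} {L : Family r} (σ : Permutation′ r) → 4 ≤ r → L ≅[ σ ] LV → LargeProperSublattice L
LV-conjugate σ 4≤r L≅LV =
  conjugate-of-dense σ L≅LV (LV-closed 4≤r) (arrow⇒proper (LV-closed 4≤r) p₀≢p₁ (inj₁ (toℕ-inject≤ 0F 4≤r , toℕ-inject≤ 1F 4≤r)))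
    twoImplications (firstPoints 4≤r) (firstPoints-injective 4≤r) (LV-pattern 4≤r) by-computation
  where
  p₀≢p₁ : firstPoints 4≤r 0F ≢ firstPoints 4≤r 1F
  p₀≢p₁ e with firstPoints-injective 4≤r e
  ... | ()

-- The properties are invariant under pointwise equality and under duality; hence conjugates of
-- L′_i = dual L_i are large proper sublattices too.
large-proper-sublattice-cong : ∀ {r} {F G : Family r} → (∀ X → F X ≡ G X) → LargeProperSublattice F → LargeProperSublattice G
large-proper-sublattice-cong {r} {F} {G} F≗G (((X , FX) , ∪-closed , ∩-closed) , (Y , Y∉F) , large) =
  ((X , via FX) , (λ X Y GX GY → via (∪-closed X Y (back GX) (back GY))) , (λ X Y GX GY → via (∩-closed X Y (back GX) (back GY)))) ,
  (Y , trans (sym (F≗G Y)) Y∉F) ,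
  subst (λ n → 2 ^ r < 2 * n) (size-cong F≗G) large
  where
  via : ∀ {Z} → F Z ≡ true → G Z ≡ true
  via {Z} FZ = trans (sym (F≗G Z)) FZ
  back : ∀ {Z} → G Z ≡ true → F Z ≡ true
  back {Z} GZ = trans (F≗G Z) GZ

L′fam-conjugate : ∀ {r} {L : Family r} (σ : Permutation′ r) i → 1 ≤ i → i < r → L ≅[ σ ] L′fam i → LargeProperSublattice L
L′fam-conjugate {L = L} σ i 1≤i i<r L≅L′ᵢ = dual-back (Lfam-conjugate σ i 1≤i i<r dual≅Lᵢ)
  where
  dual≅Lᵢ : dual L ≅[ σ ] Lfam i
  dual≅Lᵢ X = trans (dual-≅ {L = L} σ L≅L′ᵢ X) (trans (L′fam-dual i (∁ X)) (cong (Lfam i) (∁-involutive X)))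
  dual-back : LargeProperSublattice (dual L) → LargeProperSublattice L
  dual-back (sublattice , proper , large) = large-proper-sublattice-cong (dual-dual L)
    (dual-sublattice (dual L) sublattice , dual-proper (dual L) proper , dual-large (dual L) large)

standard⇒large-proper-sublattice : ∀ {r} (L : Family r) → Standard L → LargeProperSublattice L
standard⇒large-proper-sublattice L (σ , inj₁ (i , 1≤i , i<r , L≅Lᵢ)) = Lfam-conjugate σ i 1≤i i<r L≅Lᵢ
standard⇒large-proper-sublattice L (σ , inj₂ (inj₁ (i , 1≤i , i<r , L≅L′ᵢ))) = L′fam-conjugate σ i 1≤i i<r L≅L′ᵢ
standard⇒large-proper-sublattice L (σ , inj₂ (inj₂ (4≤r , L≅LV))) = LV-conjugate σ 4≤r L≅LV

-- A sublattice containing L_V has its arrows among 0 → 1 and 2 → 3; so it is cut out by the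
-- pattern of those of the two arrows it has, of density 1, 3/4 or 9/16, never 5/8.
module AboveLV {r} (4≤r : 4 ≤ r) (L : Family r) (sublattice : IsSublattice L) (LV⊑L : LV ⊑ L) where

  ∪-closed : ∪-Closed L
  ∪-closed = proj₁ (proj₂ sublattice)

  ∩-closed : ∩-Closed L
  ∩-closed = proj₂ (proj₂ sublattice)

  -- L contains ∅ and [r] because L_V does.
  L∋⊥ : L ⊥ ≡ true
  L∋⊥ = LV⊑L ⊥ (proj₂ (LV-closed 4≤r ⊥) (λ a b _ a∊⊥ → ⊥-elim (false≢true (lookup-⊥ a) a∊⊥)))

  L∋⊤ : L ⊤ ≡ true
  L∋⊤ = LV⊑L ⊤ (proj₂ (LV-closed 4≤r ⊤) (closed-⊤ Matching))

  open Birkhoff L ∪-closed ∩-closed L∋⊥ L∋⊤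

  matching? : ∀ a b → Dec (Matching {r} a b)
  matching? a b = ((toℕ a ≟ 0) ×-dec (toℕ b ≟ 1)) ⊎-dec ((toℕ a ≟ 2) ×-dec (toℕ b ≟ 3))

  -- The largest member of L_V avoiding q: drop q and the source of an arrow into q.
  avoiding : Fin r → Subset r
  avoiding q = tabulate (λ k → not (does (k Finₚ.≟ q)) ∧ not (does (matching? k q)))

  avoiding⇐ : ∀ {q k} → k ≢ q → ¬ Matching k q → k ∊ avoiding q
  avoiding⇐ {q} {k} k≢q ¬k→q = trans (lookup∘tabulate _ k)
    (cong₂ (λ x y → not x ∧ not y) (dec-false (k Finₚ.≟ q) k≢q) (dec-false (matching? k q) ¬k→q))

  avoiding-q : ∀ q → ¬ q ∊ avoiding q
  avoiding-q q q∊ with trans (sym (trans (lookup∘tabulate _ q) (cong (λ x → not x ∧ not (does (matching? q q))) (dec-true (q Finₚ.≟ q) refl)))) q∊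
  ... | ()

  avoiding-source : ∀ {p q} → Matching p q → ¬ p ∊ avoiding q
  avoiding-source {p} {q} p→q p∊ with trans (sym (trans (lookup∘tabulate _ p)
         (trans (cong (λ y → not (does (p Finₚ.≟ q)) ∧ not y) (dec-true (matching? p q) p→q)) (∧-zeroʳ _)))) p∊
  ... | ()

  no-chain : ∀ {a b c} → Matching {r} a b → ¬ Matching b c
  no-chain (inj₁ (_ , b≡1)) (inj₁ (b≡0 , _)) with trans (sym b≡1) b≡0
  ... | ()
  no-chain (inj₁ (_ , b≡1)) (inj₂ (b≡2 , _)) with trans (sym b≡1) b≡2
  ... | ()
  no-chain (inj₂ (_ , b≡3)) (inj₁ (b≡0 , _)) with trans (sym b≡3) b≡0
  ... | ()
  no-chain (inj₂ (_ , b≡3)) (inj₂ (b≡2 , _)) with trans (sym b≡3) b≡2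
  ... | ()

  avoiding-closed : ∀ q → Closed Matching (avoiding q)
  avoiding-closed q a b a→b a∊ = avoiding⇐ b≢q (no-chain a→b)
    where
    b≢q : b ≢ q
    b≢q refl = avoiding-source a→b a∊

  -- Every arrow of L is an arrow of L_V: the member `avoiding q` of L_V ⊆ L separates p from q.
  arrows-in-matching : ∀ {p q} → p ≢ q → p ⇝ q → Matching p q
  arrows-in-matching {p} {q} p≢q p⇝q with matching? p q
  ... | yes p→q = p→q
  ... | no ¬p→q = ⊥-elim (avoiding-q q (⇝-elim p⇝q (avoiding q) (LV⊑L _ (proj₂ (LV-closed 4≤r _) (avoiding-closed q)))
                                          (avoiding⇐ p≢q ¬p→q)))

  guarded : Bool → Bool → Vec Bool 4 → Bool
  guarded u w (x₀ ∷ x₁ ∷ x₂ ∷ x₃ ∷ []) = (not u ∨ not x₀ ∨ x₁) ∧ (not w ∨ not x₂ ∨ x₃)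

  guard : ∀ {u x y} → (u ≡ true → x ≡ true → y ≡ true) → not u ∨ not x ∨ y ≡ true
  guard {false} _ = refl
  guard {true} {false} _ = refl
  guard {true} {true} u⇒x⇒y = u⇒x⇒y refl refl

  unguard : ∀ {u x y} → not u ∨ not x ∨ y ≡ true → u ≡ true → x ≡ true → y ≡ true
  unguard {true} {true} y refl refl = y

  p : Fin 4 → Fin r
  p = firstPoints 4≤r

  at : ∀ {a} j → toℕ a ≡ toℕ j → a ≡ p j
  at j a≡j = toℕ-injective (trans a≡j (sym (toℕ-inject≤ j 4≤r)))

  has₀₁ has₂₃ : Bool
  has₀₁ = lookup (↑ p 0F) (p 1F)
  has₂₃ = lookup (↑ p 2F) (p 3F)

  L-pattern : ∀ X → L X ≡ Pattern (guarded has₀₁ has₂₃) p X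
  L-pattern X = bool-ext
    (λ X∈L → ∧-intro (guard (proj₁ (birkhoff X) X∈L (p 0F) (p 1F))) (guard (proj₁ (birkhoff X) X∈L (p 2F) (p 3F))))
    (λ X∈P → proj₂ (birkhoff X) (closed (∧-elim X∈P)))
    where
    closed : (not has₀₁ ∨ not (lookup X (p 0F)) ∨ lookup X (p 1F)) ≡ true
           × (not has₂₃ ∨ not (lookup X (p 2F)) ∨ lookup X (p 3F)) ≡ true → Closed _⇝_ X
    closed (first , second) a b a⇝b a∊X with a Finₚ.≟ b
    ... | yes refl = a∊X
    ... | no a≢b with arrows-in-matching a≢b a⇝b
    ...   | inj₁ (a≡0 , b≡1) rewrite at 0F a≡0 | at 1F b≡1 = unguard first a⇝b a∊X
    ...   | inj₂ (a≡2 , b≡3) rewrite at 2F a≡2 | at 3F b≡3 = unguard second a⇝b a∊X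

  count-guarded : ∀ u w → count 4 (guarded u w) ≢ 10
  count-guarded true true ()
  count-guarded true false ()
  count-guarded false true ()
  count-guarded false false ()

  no-five-eighths : 8 * size L ≢ 5 * 2 ^ r
  no-five-eighths 8L≡5·2ʳ = count-guarded has₀₁ has₂₃ (*-cancelʳ-≡ _ 10 (2 ^ r) {{m^n≢0 2 r}} (begin
    count 4 (guarded has₀₁ has₂₃) * 2 ^ r        ≡⟨ sym (pattern-size 4 (guarded has₀₁ has₂₃) p (firstPoints-injective 4≤r)) ⟩
    16 * size (Pattern (guarded has₀₁ has₂₃) p)  ≡⟨ cong (16 *_) (sym (size-cong L-pattern)) ⟩
    16 * size L                                  ≡⟨ *-assoc 2 8 (size L) ⟩
    2 * (8 * size L)                             ≡⟨ cong (2 *_) 8L≡5·2ʳ ⟩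
    2 * (5 * 2 ^ r)                              ≡⟨ sym (*-assoc 2 5 (2 ^ r)) ⟩
    10 * 2 ^ r ∎))
    where open ≡-Reasoning

large⇒card : ∀ {r} {L : Family r} → Large L → 2 ^ r < 2 * card L
large⇒card {r} {L} = subst (λ n → 2 ^ r < 2 * n) (sym (card≡size L))

card⇒large : ∀ {r} {L : Family r} → 2 ^ r < 2 * card L → Large L
card⇒large {r} {L} = subst (λ n → 2 ^ r < 2 * n) (card≡size L)

lemma4p3 : ∀ (r : ℕ) →
    (∀ (L : Family r) →
      ((IsSublattice L × IsProper L × 2 ^ r < 2 * card L) →
        ∃ λ (σ : Permutation′ r) →
          (∃ λ i → 1 ≤ i × i < r × L ≅[ σ ] Lfam i)
          ⊎ (∃ λ i → 1 ≤ i × i < r × L ≅[ σ ] L′fam i)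
          ⊎ (4 ≤ r × L ≅[ σ ] LV))
      ×
      ((∃ λ (σ : Permutation′ r) →
          (∃ λ i → 1 ≤ i × i < r × L ≅[ σ ] Lfam i)
          ⊎ (∃ λ i → 1 ≤ i × i < r × L ≅[ σ ] L′fam i)
          ⊎ (4 ≤ r × L ≅[ σ ] LV)) →
        IsSublattice L × IsProper L × 2 ^ r < 2 * card L))
    ×
    (∀ i → 1 ≤ i → i < r →
      (2 ^ suc i * card (Lfam {r} i) ≡ (2 ^ i + 1) * 2 ^ r)
      × (2 ^ suc i * card (L′fam {r} i) ≡ (2 ^ i + 1) * 2 ^ r))
    ×
    (4 ≤ r →
      (16 * card (LV {r}) ≡ 9 * 2 ^ r)
      × ¬ (∃ λ (L : Family r) → IsSublattice L × 8 * card L ≡ 5 * 2 ^ r × LV ⊑ L))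
lemma4p3 r = classification , sizes , above-LV
  where
  classification : ∀ (L : Family r) →
    ((IsSublattice L × IsProper L × 2 ^ r < 2 * card L) → Standard L) ×
    (Standard L → IsSublattice L × IsProper L × 2 ^ r < 2 * card L)
  classification L =
    (λ { (sublattice , proper , big) → classify L (sublattice , proper , card⇒large {L = L} big) }) ,
    (λ standard → let (sublattice , proper , large) = standard⇒large-proper-sublattice L standard
                  in sublattice , proper , large⇒card {L = L} large)
  sizes : ∀ i → 1 ≤ i → i < r →
    (2 ^ suc i * card (Lfam {r} i) ≡ (2 ^ i + 1) * 2 ^ r) × (2 ^ suc i * card (L′fam {r} i) ≡ (2 ^ i + 1) * 2 ^ r)
  sizes i _ i<r = trans (cong (2 ^ suc i *_) (card≡size (Lfam {r} i))) (Lfam-size i i<r) ,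
                  trans (cong (2 ^ suc i *_) (card≡size (L′fam {r} i))) (L′fam-size i i<r)
  above-LV : 4 ≤ r → (16 * card (LV {r}) ≡ 9 * 2 ^ r) ×
    ¬ (∃ λ (L : Family r) → IsSublattice L × 8 * card L ≡ 5 * 2 ^ r × LV ⊑ L)
  above-LV 4≤r = trans (cong (16 *_) (card≡size (LV {r}))) (LV-size 4≤r) ,
    λ { (L , sublattice , 8L≡5·2ʳ , LV⊑L) →
          AboveLV.no-five-eighths 4≤r L sublattice LV⊑L (trans (cong (8 *_) (sym (card≡size L))) 8L≡5·2ʳ) }
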